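{- Let $p$ be a prime, and define $d_1=1$, $d_2=2$, $d_{j+1}=p^{D_j-3}$ for $j\geq2$, where $D_0=0$ and $D_i=d_1+\dots+d_i$. Let $e_1,\dots,e_n$ be the standard basis of $\mathbb{F}_p^n$, and for $i\geq0$ with $D_i\leq n$ let $H_i=\langle e_1,\dots,e_{D_i}\rangle^\perp=\{0\}^{D_i}\times\mathbb{F}_p^{n-D_i}$ and $U_i=\mathbb{F}_p^{D_i}\times\{0\}^{n-D_i}$. Then for each $i\geq1$ with $D_i\leq n$ there is a tuple $X_i=(\xi^{(i)}_u: u\in U_{i-1})$ of non-zero vectors $\xi^{(i)}_u\in H_{i-1}$ such that the span of any subfamily $X'\subseteq X_i$ with $|X'|\geq\frac34|X_i|$ equals $\langle e_{D_{i-1}+1},\dots,e_{D_i}\rangle$.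
   Context: For $S\subseteq\mathbb{F}_p^n$, $\langle S\rangle$ is its span and $\langle S\rangle^\perp=\{x:x^Ty=0\ \forall y\in S\}$ with $x^Ty=\sum_kx_ky_k$. -}

module Defs where

open import Data.Nat using (ℕ; zero; suc; _+_; _*_; _∸_; _^_; _≤_; _<_; NonZero)
open import Data.Nat.DivMod using (_mod_)
open import Data.Fin using (Fin; toℕ; _≟_)
open import Data.Vec using (Vec; replicate; zipWith; foldr; tabulate)
open import Data.List using (List)
open import Data.List.Relation.Unary.All using (All)
open import Data.Product using (Σ; _×_; _,_; ∃)
open import Relation.Binary.PropositionalEquality using (_≡_)
open import Relation.Nullary using (yes; no)

-- The sequences d_j and D_i (d 0 is unused and set to 0; D 0 = 0).
mutual
  d : ℕ → ℕ → ℕ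
  d p zero = 0
  d p (suc zero) = 1
  d p (suc (suc zero)) = 2
  d p (suc (suc (suc k))) = p ^ (D p (suc (suc k)) ∸ 3)

  D : ℕ → ℕ → ℕ
  D p zero = 0
  D p (suc i) = D p i + d p (suc i)

module _ (p : ℕ) .{{_ : NonZero p}} where

  F : Set
  F = Fin p

  0F 1F : F
  0F = 0 mod p
  1F = 1 mod p

  _+F_ _*F_ : F → F → F
  a +F b = (toℕ a + toℕ b) mod p
  a *F b = (toℕ a * toℕ b) mod p

  Vecₚ : ℕ → Set
  Vecₚ n = Vec F n

  0V : ∀ {n} → Vecₚ n
  0V = replicate _ 0F

  _+V_ : ∀ {n} → Vecₚ n → Vecₚ n → Vecₚ n
  _+V_ = zipWith _+F_

  _·V_ : ∀ {n} → F → Vecₚ n → Vecₚ n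
  c ·V v = Data.Vec.map (c *F_) v

  dot : ∀ {n} → Vecₚ n → Vecₚ n → F
  dot x y = foldr _ _+F_ 0F (zipWith _*F_ x y)

  lincomb : ∀ {n} → List (F × Vecₚ n) → Vecₚ n
  lincomb Data.List.[] = 0V
  lincomb ((c , w) Data.List.∷ cs) = (c ·V w) +V lincomb cs

  InSpan : ∀ {n} → (Vecₚ n → Set) → Vecₚ n → Set
  InSpan S v = Σ (List (F × _)) λ cs → All (λ cw → S (Data.Product.proj₂ cw)) cs × lincomb cs ≡ v

  InPerp : ∀ {n} → (Vecₚ n → Set) → Vecₚ n → Set
  InPerp S x = ∀ y → InSpan S y → dot x y ≡ 0F

  -- standard basis vector e_k (k is 0-indexed: Fin n index k is e_{k+1})
  e : ∀ {n} → Fin n → Vecₚ n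
  e k = tabulate λ j → Data.Bool.if Relation.Nullary.Decidable.⌊ j ≟ k ⌋ then 1F else 0F
    where import Data.Bool; import Relation.Nullary.Decidable

  -- the set {e_{a+1}, …, e_b}  (1-indexed as in the paper)
  Es : ∀ {n} → ℕ → ℕ → Vecₚ n → Set
  Es {n} a b v = ∃ λ (k : Fin n) → (a ≤ toℕ k × toℕ k < b) × v ≡ e k

  InH : ∀ {n} → ℕ → Vecₚ n → Set
  InH i = InPerp (Es 0 (D p i))

  InU : ∀ {n} → ℕ → Vecₚ n → Set
  InU {n} i u = ∀ (k : Fin n) → D p i ≤ toℕ k → Data.Vec.lookup u k ≡ 0F

module Submission where

-- Write a = D_{i-1}, N = p^a, m = d_i, and index U_{i-1} by Fin N through the first a coordinates.
-- It suffices to find m rows in F_p^N, one of them all-ones, such that every nonzero combination of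
-- them has fewer than 3N/4 zero coordinates: ξ_u is the u-th column placed in coordinates a+1, …, a+m.
-- If the columns of some 3N/4 indices u did not span F_p^m, a nonzero β orthogonal to all of them
-- would give a combination of the rows vanishing at those indices.
-- For i = 1, 2 the rows 𝟙, resp. 𝟙 and (0, 1, …, p-1), do. For i ≥ 3 the rows are chosen greedily:
-- by a Markov bound on 3^(number of zeros), for each of the p^(j+1) pairs (β, λ ≠ 0) at most
-- (p+2)^N / 3^⌈3N/4⌉ vectors ρ make λρ + Σ β r bad, and N = p³m makes the total less than p^N.

open import Defs
open import Data.Nat using (ℕ; zero; suc; _+_; _*_; _∸_; _^_; _≤_; _<_; NonZero; s≤s; z≤n; _≤?_; _<?_; _/_; _%_; ≢-nonZero; >-nonZero⁻¹; nonTrivial⇒n>1)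
open import Data.Nat.Properties hiding (_≟_)
open import Data.Nat.DivMod using (_mod_; m≡m%n+[m/n]*n; m%n<n; %-distribˡ-+; %-distribˡ-*; [m+kn]%n≡m%n; m*n%n≡0; m<n⇒m%n≡m)
open import Data.Nat.Primality using (Prime; prime)
open import Data.Nat.Coprimality using (prime⇒coprime; coprime-Bézout)
import Data.Nat.GCD as GCD
open import Data.Nat.Tactic.RingSolver using (solve-∀)
open import Data.Fin using (Fin; toℕ; fromℕ<; cast; _≟_; combine) renaming (zero to fzero; suc to fsuc)
open import Data.Fin.Properties using (cast-involutive; toℕ-injective; toℕ<n; toℕ-fromℕ<; combine-injective) renaming (suc-injective to fsuc-injective)
open import Data.Vec using (Vec; []; _∷_; lookup; replicate; tabulate)
import Data.Vec as Vec
open import Data.Vec.Properties using (∷-injectiveˡ; ∷-injectiveʳ; tabulate-cong; lookup∘tabulate; lookup-zipWith; lookup-map; lookup-replicate)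
open import Data.List using (List; []; _∷_; _++_; length; allFin; concatMap)
import Data.List as List
import Data.List.Properties as List
open import Data.List.Relation.Unary.All using (All; []; _∷_)
import Data.List.Relation.Unary.All as All
import Data.List.Relation.Unary.All.Properties as All
open import Data.List.Relation.Unary.AllPairs using ([]; _∷_)
open import Data.List.Relation.Unary.Any using (here; there)
open import Data.List.Relation.Unary.Unique.Propositional using (Unique)
import Data.List.Relation.Unary.Unique.Propositional.Properties as Unique
open import Data.List.Membership.Propositional using (_∈_)
import Data.List.Membership.Propositional.Properties as Membership
open import Data.Product using (Σ; _×_; _,_; ∃; proj₁; proj₂)
open import Data.Sum using (_⊎_; inj₁; inj₂)
open import Data.Empty using (⊥-elim)
open import Data.Bool using (if_then_else_)
open import Relation.Binary.PropositionalEquality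
open import Relation.Nullary using (¬_; yes; no)
open import Relation.Nullary.Decidable using (⌊_⌋; isYes≗does)

private
  variable
    A B : Set

sumBy : List A → (A → ℕ) → ℕ
sumBy [] f = 0
sumBy (x ∷ xs) f = f x + sumBy xs f

sumBy-cong : ∀ (xs : List A) {f g} → (∀ x → f x ≡ g x) → sumBy xs f ≡ sumBy xs g
sumBy-cong [] eq = refl
sumBy-cong (x ∷ xs) eq = cong₂ _+_ (eq x) (sumBy-cong xs eq)

sumBy-mono-≤ : ∀ (xs : List A) {f g} → (∀ x → f x ≤ g x) → sumBy xs f ≤ sumBy xs g
sumBy-mono-≤ [] le = z≤n
sumBy-mono-≤ (x ∷ xs) le = +-mono-≤ (le x) (sumBy-mono-≤ xs le)

sumBy-const : ∀ (xs : List A) c → sumBy xs (λ _ → c) ≡ length xs * c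
sumBy-const [] c = refl
sumBy-const (x ∷ xs) c = cong (c +_) (sumBy-const xs c)

sumBy-++ : ∀ (xs ys : List A) f → sumBy (xs ++ ys) f ≡ sumBy xs f + sumBy ys f
sumBy-++ [] ys f = refl
sumBy-++ (x ∷ xs) ys f = trans (cong (f x +_) (sumBy-++ xs ys f)) (sym (+-assoc (f x) _ _))

sumBy-*ˡ : ∀ (xs : List A) c f → sumBy xs (λ x → c * f x) ≡ c * sumBy xs f
sumBy-*ˡ [] c f = sym (*-zeroʳ c)
sumBy-*ˡ (x ∷ xs) c f = trans (cong (c * f x +_) (sumBy-*ˡ xs c f)) (sym (*-distribˡ-+ c (f x) _))

sumBy-+ : ∀ (xs : List A) f g → sumBy xs (λ x → f x + g x) ≡ sumBy xs f + sumBy xs g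
sumBy-+ [] f g = refl
sumBy-+ (x ∷ xs) f g = trans (cong (f x + g x +_) (sumBy-+ xs f g)) (+-interchange (f x) (g x) _ _)
  where
  +-interchange : ∀ a b c d → a + b + (c + d) ≡ a + c + (b + d)
  +-interchange = solve-∀

sumBy-swap : ∀ (xs : List A) (ys : List B) (f : A → B → ℕ) →
             sumBy xs (λ a → sumBy ys (f a)) ≡ sumBy ys (λ b → sumBy xs (λ a → f a b))
sumBy-swap [] ys f = sym (trans (sumBy-const ys 0) (*-zeroʳ (length ys)))
sumBy-swap (x ∷ xs) ys f = trans (cong (sumBy ys (f x) +_) (sumBy-swap xs ys f)) (sym (sumBy-+ ys (f x) _))

sumBy-concatMap : ∀ (g : B → List A) (xs : List B) f → sumBy (concatMap g xs) f ≡ sumBy xs (λ x → sumBy (g x) f)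
sumBy-concatMap g [] f = refl
sumBy-concatMap g (x ∷ xs) f = trans (sumBy-++ (g x) (concatMap g xs) f) (cong (sumBy (g x) f +_) (sumBy-concatMap g xs f))

sumBy-map : ∀ (g : B → A) (xs : List B) f → sumBy (List.map g xs) f ≡ sumBy xs (λ x → f (g x))
sumBy-map g [] f = refl
sumBy-map g (x ∷ xs) f = cong (f (g x) +_) (sumBy-map g xs f)

sumBy≡0⇒∈⇒≡0 : ∀ (xs : List A) f → sumBy xs f ≡ 0 → ∀ {x} → x ∈ xs → f x ≡ 0
sumBy≡0⇒∈⇒≡0 (y ∷ xs) f eq (here refl) = m+n≡0⇒m≡0 (f y) eq
sumBy≡0⇒∈⇒≡0 (y ∷ xs) f eq (there x∈) = sumBy≡0⇒∈⇒≡0 xs f (m+n≡0⇒n≡0 (f y) eq) x∈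

sumBy<length⇒∃≡0 : ∀ (xs : List A) f → sumBy xs f < length xs → ∃ λ x → x ∈ xs × f x ≡ 0
sumBy<length⇒∃≡0 (x ∷ xs) f lt with f x in eq
... | zero = x , here refl , eq
... | suc k with sumBy<length⇒∃≡0 xs f (≤-trans (s≤s (m≤n+m (sumBy xs f) k)) (≤-pred lt))
...   | y , y∈ , fy≡0 = y , there y∈ , fy≡0

unique⊆⇒length≤ : ∀ (xs ys : List A) → Unique xs → All (_∈ ys) xs → length xs ≤ length ys
unique⊆⇒length≤ [] ys _ _ = z≤n
unique⊆⇒length≤ (x ∷ xs) ys (x∉xs ∷ uxs) (x∈ys ∷ xs⊆ys) =
  subst (suc (length xs) ≤_) (length-remove ys x∈ys)
    (s≤s (unique⊆⇒length≤ xs (remove ys x∈ys) uxs (All.zipWith (λ (x≢y , y∈) → ∈-remove ys x∈ys y∈ x≢y) (x∉xs , xs⊆ys))))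
  where
  remove : ∀ {x} (ys : List A) → x ∈ ys → List A
  remove (y ∷ ys) (here _) = ys
  remove (y ∷ ys) (there x∈) = y ∷ remove ys x∈

  length-remove : ∀ {x} (ys : List A) (x∈ : x ∈ ys) → suc (length (remove ys x∈)) ≡ length ys
  length-remove (y ∷ ys) (here _) = refl
  length-remove (y ∷ ys) (there x∈) = cong suc (length-remove ys x∈)

  ∈-remove : ∀ {x z} (ys : List A) (x∈ : x ∈ ys) → z ∈ ys → x ≢ z → z ∈ remove ys x∈
  ∈-remove (y ∷ ys) (here refl) (here refl) x≢z = ⊥-elim (x≢z refl)
  ∈-remove (y ∷ ys) (here refl) (there z∈) _ = z∈
  ∈-remove (y ∷ ys) (there x∈) (here z≡y) _ = here z≡y
  ∈-remove (y ∷ ys) (there x∈) (there z∈) x≢z = there (∈-remove ys x∈ z∈ x≢z)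

Unique-map⁺-on : ∀ (f : A → B) (P : A → Set) (xs : List A) → Unique xs → All P xs →
                 (∀ {x y} → P x → P y → f x ≡ f y → x ≡ y) → Unique (List.map f xs)
Unique-map⁺-on f P [] _ _ inj = []
Unique-map⁺-on f P (x ∷ xs) (x∉xs ∷ uxs) (px ∷ pxs) inj =
  All.map⁺ (All.zipWith (λ (x≢y , py) fx≡fy → x≢y (inj px py fx≡fy)) (x∉xs , pxs)) ∷ Unique-map⁺-on f P xs uxs pxs inj

[m*n]^o≡m^o*n^o : ∀ m n o → (m * n) ^ o ≡ m ^ o * n ^ o
[m*n]^o≡m^o*n^o m n zero = refl
[m*n]^o≡m^o*n^o m n (suc o) = trans (cong (m * n *_) ([m*n]^o≡m^o*n^o m n o)) (*-interchange m n (m ^ o) (n ^ o))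
  where
  *-interchange : ∀ a b c d → a * b * (c * d) ≡ a * c * (b * d)
  *-interchange = solve-∀

[m^n]^o≡[m^o]^n : ∀ m n o → (m ^ n) ^ o ≡ (m ^ o) ^ n
[m^n]^o≡[m^o]^n m n o = trans (^-*-assoc m n o) (trans (cong (m ^_) (*-comm n o)) (sym (^-*-assoc m o n)))

m^4<n^4⇒m<n : ∀ m n → m ^ 4 < n ^ 4 → m < n
m^4<n^4⇒m<n m n lt with m <? n
... | yes m<n = m<n
... | no m≮n = ⊥-elim (<⇒≱ lt (^-monoˡ-≤ 4 (≮⇒≥ m≮n)))

[2+k]^4<8^[2+k] : ∀ k → (2 + k) ^ 4 < 8 ^ (2 + k)
[2+k]^4<8^[2+k] zero = ≤ᵇ⇒≤ 17 64 _
[2+k]^4<8^[2+k] (suc k) = begin-strict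
    (3 + k) ^ 4      ≤⟨ subst ((3 + k) ^ 4 ≤_) (expand k) (m≤m+n _ _) ⟩
    8 * (2 + k) ^ 4  <⟨ *-monoʳ-< 8 ([2+k]^4<8^[2+k] k) ⟩
    8 ^ (3 + k)      ∎
  where
  open ≤-Reasoning
  -- stated with products, to which _^_ unfolds, since the ring solver does not accept _^_
  expand : ∀ k → (3 + k) * ((3 + k) * ((3 + k) * ((3 + k) * 1)))
                   + (7 * (k * (k * (k * (k * 1)))) + 52 * (k * (k * (k * 1))) + 138 * (k * (k * 1)) + 148 * k + 47)
                 ≡ 8 * ((2 + k) * ((2 + k) * ((2 + k) * ((2 + k) * 1))))
  expand = solve-∀

4[2+k]≤[2+k]^3 : ∀ k → 4 * (2 + k) ≤ (2 + k) ^ 3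
4[2+k]≤[2+k]^3 k = subst (4 * (2 + k) ≤_) (expand k) (m≤m+n _ _)
  where
  expand : ∀ k → 4 * (2 + k) + (k * k * k + 6 * k * k + 8 * k) ≡ (2 + k) * ((2 + k) * ((2 + k) * 1))
  expand = solve-∀

-- with K = q³ ≥ 4q, split 16^K as 16^(4q) 16^(K - 4q) and use 8 · 16⁴ ≤ 27⁴
q^4*16^K<27^K : ∀ k → (2 + k) ^ 4 * 16 ^ ((2 + k) ^ 3) < 27 ^ ((2 + k) ^ 3)
q^4*16^K<27^K k = begin-strict
    q ^ 4 * 16 ^ K                  <⟨ *-monoˡ-< (16 ^ K) {{m^n≢0 16 K}} ([2+k]^4<8^[2+k] k) ⟩
    8 ^ q * 16 ^ K                  ≡⟨ cong (λ e → 8 ^ q * 16 ^ e) K≡4q+r ⟩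
    8 ^ q * 16 ^ (4 * q + r)        ≡⟨ cong (8 ^ q *_) (^-distribˡ-+-* 16 (4 * q) r) ⟩
    8 ^ q * (16 ^ (4 * q) * 16 ^ r) ≡⟨ sym (*-assoc (8 ^ q) _ _) ⟩
    8 ^ q * 16 ^ (4 * q) * 16 ^ r   ≤⟨ *-mono-≤ head (^-monoˡ-≤ r (≤ᵇ⇒≤ 16 27 _)) ⟩
    27 ^ (4 * q) * 27 ^ r           ≡⟨ sym (^-distribˡ-+-* 27 (4 * q) r) ⟩
    27 ^ (4 * q + r)                ≡⟨ cong (27 ^_) (sym K≡4q+r) ⟩
    27 ^ K                          ∎
  where
  open ≤-Reasoning
  q = 2 + k
  K = q ^ 3
  r = K ∸ 4 * q
  K≡4q+r : K ≡ 4 * q + r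
  K≡4q+r = sym (m+[n∸m]≡n (4[2+k]≤[2+k]^3 k))
  head : 8 ^ q * 16 ^ (4 * q) ≤ 27 ^ (4 * q)
  head = begin
    8 ^ q * 16 ^ (4 * q)  ≡⟨ cong (8 ^ q *_) (sym (^-*-assoc 16 4 q)) ⟩
    8 ^ q * (16 ^ 4) ^ q  ≡⟨ sym ([m*n]^o≡m^o*n^o 8 (16 ^ 4) q) ⟩
    (8 * 16 ^ 4) ^ q      ≤⟨ ^-monoˡ-≤ q (≤ᵇ⇒≤ (8 * 16 ^ 4) (27 ^ 4) _) ⟩
    (27 ^ 4) ^ q          ≡⟨ ^-*-assoc 27 4 q ⟩
    27 ^ (4 * q)          ∎

-- Raising to the fourth power turns 3^z into at least 27^N, after which (q + 2)^4 ≤ 16 q^4 reduces everything to q^4*16^K<27^K.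
q^m*[q+2]^N<q^N*3^z : ∀ q → 1 < q → ∀ m .{{_ : NonZero m}} z → 3 * (q ^ 3 * m) ≤ 4 * z →
                      q ^ m * (q + 2) ^ (q ^ 3 * m) < q ^ (q ^ 3 * m) * 3 ^ z
q^m*[q+2]^N<q^N*3^z (suc zero) (s≤s ()) m z 3N≤4z
q^m*[q+2]^N<q^N*3^z (suc (suc k)) _ m z 3N≤4z = m^4<n^4⇒m<n _ _ (begin-strict
    (q ^ m * (q + 2) ^ N) ^ 4       ≡⟨ [m*n]^o≡m^o*n^o (q ^ m) _ 4 ⟩
    (q ^ m) ^ 4 * ((q + 2) ^ N) ^ 4 ≡⟨ cong₂ _*_ ([m^n]^o≡[m^o]^n q m 4) (trans (cong (_^ 4) (sym (^-*-assoc (q + 2) K m))) ([m^n]^o≡[m^o]^n X m 4)) ⟩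
    (q ^ 4) ^ m * (X ^ 4) ^ m       ≡⟨ sym ([m*n]^o≡m^o*n^o (q ^ 4) (X ^ 4) m) ⟩
    (q ^ 4 * X ^ 4) ^ m             <⟨ ^-monoˡ-< m per-block ⟩
    ((q ^ K) ^ 4 * 27 ^ K) ^ m      ≡⟨ [m*n]^o≡m^o*n^o ((q ^ K) ^ 4) (27 ^ K) m ⟩
    ((q ^ K) ^ 4) ^ m * (27 ^ K) ^ m ≡⟨ cong₂ _*_ (trans ([m^n]^o≡[m^o]^n (q ^ K) 4 m) (cong (_^ 4) (^-*-assoc q K m))) (^-*-assoc 27 K m) ⟩
    (q ^ N) ^ 4 * 27 ^ N            ≤⟨ *-monoʳ-≤ ((q ^ N) ^ 4) 27^N≤[3^z]^4 ⟩
    (q ^ N) ^ 4 * (3 ^ z) ^ 4       ≡⟨ sym ([m*n]^o≡m^o*n^o (q ^ N) (3 ^ z) 4) ⟩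
    (q ^ N * 3 ^ z) ^ 4             ∎)
  where
  open ≤-Reasoning
  q = suc (suc k)
  K = q ^ 3
  N = K * m
  X = (q + 2) ^ K
  27^N≤[3^z]^4 : 27 ^ N ≤ (3 ^ z) ^ 4
  27^N≤[3^z]^4 = begin
    (3 ^ 3) ^ N  ≡⟨ ^-*-assoc 3 3 N ⟩
    3 ^ (3 * N)  ≤⟨ ^-monoʳ-≤ 3 (≤-trans 3N≤4z (≤-reflexive (*-comm 4 z))) ⟩
    3 ^ (z * 4)  ≡⟨ sym (^-*-assoc 3 z 4) ⟩
    (3 ^ z) ^ 4  ∎
  q+2≤2q : q + 2 ≤ 2 * q
  q+2≤2q = +-monoʳ-≤ q (s≤s (s≤s z≤n))
  per-block : q ^ 4 * X ^ 4 < (q ^ K) ^ 4 * 27 ^ K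
  per-block = begin-strict
    q ^ 4 * X ^ 4                   ≡⟨ cong (q ^ 4 *_) ([m^n]^o≡[m^o]^n (q + 2) K 4) ⟩
    q ^ 4 * ((q + 2) ^ 4) ^ K       ≤⟨ *-monoʳ-≤ (q ^ 4) (^-monoˡ-≤ K (^-monoˡ-≤ 4 q+2≤2q)) ⟩
    q ^ 4 * ((2 * q) ^ 4) ^ K       ≡⟨ cong (λ e → q ^ 4 * e ^ K) ([m*n]^o≡m^o*n^o 2 q 4) ⟩
    q ^ 4 * (16 * q ^ 4) ^ K        ≡⟨ cong (q ^ 4 *_) ([m*n]^o≡m^o*n^o 16 (q ^ 4) K) ⟩
    q ^ 4 * (16 ^ K * (q ^ 4) ^ K)  ≡⟨ sym (*-assoc (q ^ 4) (16 ^ K) _) ⟩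
    q ^ 4 * 16 ^ K * (q ^ 4) ^ K    <⟨ *-monoˡ-< ((q ^ 4) ^ K) {{m^n≢0 (q ^ 4) K {{m^n≢0 q 4}}}} (q^4*16^K<27^K k) ⟩
    27 ^ K * (q ^ 4) ^ K            ≡⟨ *-comm (27 ^ K) _ ⟩
    (q ^ 4) ^ K * 27 ^ K            ≡⟨ cong (_* 27 ^ K) ([m^n]^o≡[m^o]^n q 4 K) ⟩
    (q ^ K) ^ 4 * 27 ^ K            ∎

⌈3N/4⌉ : ℕ → ℕ
⌈3N/4⌉ N = (3 * N + 3) / 4

3N≤4⌈3N/4⌉ : ∀ N → 3 * N ≤ 4 * ⌈3N/4⌉ N
3N≤4⌈3N/4⌉ N = +-cancelʳ-≤ 3 (3 * N) (4 * ⌈3N/4⌉ N) (begin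
    3 * N + 3                          ≡⟨ m≡m%n+[m/n]*n (3 * N + 3) 4 ⟩
    (3 * N + 3) % 4 + ⌈3N/4⌉ N * 4     ≤⟨ +-monoˡ-≤ _ (≤-pred (m%n<n (3 * N + 3) 4)) ⟩
    3 + ⌈3N/4⌉ N * 4                   ≡⟨ cong (3 +_) (*-comm (⌈3N/4⌉ N) 4) ⟩
    3 + 4 * ⌈3N/4⌉ N                   ≡⟨ +-comm 3 _ ⟩
    4 * ⌈3N/4⌉ N + 3                   ∎)
  where open ≤-Reasoning

3N≤4w⇒⌈3N/4⌉≤w : ∀ N w → 3 * N ≤ 4 * w → ⌈3N/4⌉ N ≤ w
3N≤4w⇒⌈3N/4⌉≤w N w 3N≤4w = ≤-pred (*-cancelˡ-< 4 (⌈3N/4⌉ N) (suc w) (begin-strict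
    4 * ⌈3N/4⌉ N                       ≡⟨ *-comm 4 (⌈3N/4⌉ N) ⟩
    ⌈3N/4⌉ N * 4                       ≤⟨ m≤n+m _ _ ⟩
    (3 * N + 3) % 4 + ⌈3N/4⌉ N * 4     ≡⟨ sym (m≡m%n+[m/n]*n (3 * N + 3) 4) ⟩
    3 * N + 3                          ≤⟨ +-monoˡ-≤ 3 3N≤4w ⟩
    4 * w + 3                          <⟨ ≤-reflexive (expand w) ⟩
    4 * suc w                          ∎))
  where
  open ≤-Reasoning
  expand : ∀ w → suc (4 * w + 3) ≡ 4 * suc w
  expand = solve-∀

module _ (p : ℕ) .{{_ : NonZero p}} where

  infixl 6 _⊕_
  infixl 7 _⊗_

  _⊕_ _⊗_ : F p → F p → F p
  _⊕_ = _+F_ p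
  _⊗_ = _*F_ p

  𝟘 𝟙 : F p
  𝟘 = 0F p
  𝟙 = 1F p

  -- The ring laws of F p are transported from ℕ: a represents X when toℕ a ≡ X % p.
  Represents : F p → ℕ → Set
  Represents a X = toℕ a ≡ X % p

  toℕ-mod : ∀ m → toℕ (m mod p) ≡ m % p
  toℕ-mod m = toℕ-fromℕ< (m%n<n m p)

  represents-toℕ : ∀ a → Represents a (toℕ a)
  represents-toℕ a = sym (m<n⇒m%n≡m (toℕ<n a))

  represents-⊕ : ∀ {a b X Y} → Represents a X → Represents b Y → Represents (a ⊕ b) (X + Y)
  represents-⊕ {a} {b} {X} {Y} ra rb = begin
    toℕ (a ⊕ b)          ≡⟨ toℕ-mod (toℕ a + toℕ b) ⟩
    (toℕ a + toℕ b) % p  ≡⟨ cong₂ (λ u v → (u + v) % p) ra rb ⟩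
    (X % p + Y % p) % p  ≡⟨ sym (%-distribˡ-+ X Y p) ⟩
    (X + Y) % p          ∎
    where open ≡-Reasoning

  represents-⊗ : ∀ {a b X Y} → Represents a X → Represents b Y → Represents (a ⊗ b) (X * Y)
  represents-⊗ {a} {b} {X} {Y} ra rb = begin
    toℕ (a ⊗ b)            ≡⟨ toℕ-mod (toℕ a * toℕ b) ⟩
    (toℕ a * toℕ b) % p    ≡⟨ cong₂ (λ u v → (u * v) % p) ra rb ⟩
    (X % p * (Y % p)) % p  ≡⟨ sym (%-distribˡ-* X Y p) ⟩
    (X * Y) % p            ∎
    where open ≡-Reasoning

  represents-𝟘 : Represents 𝟘 0
  represents-𝟘 = toℕ-mod 0

  toℕ-𝟘 : toℕ 𝟘 ≡ 0
  toℕ-𝟘 = trans represents-𝟘 (m<n⇒m%n≡m (>-nonZero⁻¹ p))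

  represents-𝟙 : Represents 𝟙 1
  represents-𝟙 = toℕ-mod 1

  represents-≡-mod : ∀ {a b X Y} → Represents a X → Represents b Y → X % p ≡ Y % p → a ≡ b
  represents-≡-mod ra rb eq = toℕ-injective (trans ra (trans eq (sym rb)))

  represents-≡ : ∀ {a b X Y} → Represents a X → Represents b Y → X ≡ Y → a ≡ b
  represents-≡ ra rb refl = represents-≡-mod ra rb refl

  private
    R = represents-toℕ

  ⊕-comm : ∀ a b → a ⊕ b ≡ b ⊕ a
  ⊕-comm a b = represents-≡ (represents-⊕ (R a) (R b)) (represents-⊕ (R b) (R a)) (+-comm (toℕ a) (toℕ b))

  ⊕-assoc : ∀ a b c → a ⊕ b ⊕ c ≡ a ⊕ (b ⊕ c)
  ⊕-assoc a b c = represents-≡ (represents-⊕ (represents-⊕ (R a) (R b)) (R c)) (represents-⊕ (R a) (represents-⊕ (R b) (R c)))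
    (+-assoc (toℕ a) (toℕ b) (toℕ c))

  ⊗-comm : ∀ a b → a ⊗ b ≡ b ⊗ a
  ⊗-comm a b = represents-≡ (represents-⊗ (R a) (R b)) (represents-⊗ (R b) (R a)) (*-comm (toℕ a) (toℕ b))

  ⊗-assoc : ∀ a b c → a ⊗ b ⊗ c ≡ a ⊗ (b ⊗ c)
  ⊗-assoc a b c = represents-≡ (represents-⊗ (represents-⊗ (R a) (R b)) (R c)) (represents-⊗ (R a) (represents-⊗ (R b) (R c)))
    (*-assoc (toℕ a) (toℕ b) (toℕ c))

  ⊕-identityˡ : ∀ a → 𝟘 ⊕ a ≡ a
  ⊕-identityˡ a = represents-≡ (represents-⊕ represents-𝟘 (R a)) (R a) refl

  ⊕-identityʳ : ∀ a → a ⊕ 𝟘 ≡ a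
  ⊕-identityʳ a = trans (⊕-comm a 𝟘) (⊕-identityˡ a)

  ⊗-identityˡ : ∀ a → 𝟙 ⊗ a ≡ a
  ⊗-identityˡ a = represents-≡ (represents-⊗ represents-𝟙 (R a)) (R a) (*-identityˡ (toℕ a))

  ⊗-identityʳ : ∀ a → a ⊗ 𝟙 ≡ a
  ⊗-identityʳ a = trans (⊗-comm a 𝟙) (⊗-identityˡ a)

  ⊗-zeroˡ : ∀ a → 𝟘 ⊗ a ≡ 𝟘
  ⊗-zeroˡ a = represents-≡ (represents-⊗ represents-𝟘 (R a)) represents-𝟘 refl

  ⊗-zeroʳ : ∀ a → a ⊗ 𝟘 ≡ 𝟘
  ⊗-zeroʳ a = trans (⊗-comm a 𝟘) (⊗-zeroˡ a)

  ⊗-distribˡ-⊕ : ∀ a b c → a ⊗ (b ⊕ c) ≡ a ⊗ b ⊕ a ⊗ c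
  ⊗-distribˡ-⊕ a b c = represents-≡ (represents-⊗ (R a) (represents-⊕ (R b) (R c)))
    (represents-⊕ (represents-⊗ (R a) (R b)) (represents-⊗ (R a) (R c))) (*-distribˡ-+ (toℕ a) (toℕ b) (toℕ c))

  ⊗-distribʳ-⊕ : ∀ a b c → (b ⊕ c) ⊗ a ≡ b ⊗ a ⊕ c ⊗ a
  ⊗-distribʳ-⊕ a b c = trans (⊗-comm (b ⊕ c) a) (trans (⊗-distribˡ-⊕ a b c) (cong₂ _⊕_ (⊗-comm a b) (⊗-comm a c)))

  ⊕-interchange : ∀ a b c d → (a ⊕ b) ⊕ (c ⊕ d) ≡ (a ⊕ c) ⊕ (b ⊕ d)
  ⊕-interchange a b c d = begin
    (a ⊕ b) ⊕ (c ⊕ d)  ≡⟨ ⊕-assoc a b (c ⊕ d) ⟩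
    a ⊕ (b ⊕ (c ⊕ d))  ≡⟨ cong (a ⊕_) (sym (⊕-assoc b c d)) ⟩
    a ⊕ (b ⊕ c ⊕ d)    ≡⟨ cong (λ x → a ⊕ (x ⊕ d)) (⊕-comm b c) ⟩
    a ⊕ (c ⊕ b ⊕ d)    ≡⟨ cong (a ⊕_) (⊕-assoc c b d) ⟩
    a ⊕ (c ⊕ (b ⊕ d))  ≡⟨ sym (⊕-assoc a c (b ⊕ d)) ⟩
    (a ⊕ c) ⊕ (b ⊕ d)  ∎
    where open ≡-Reasoning

  ⊖_ : F p → F p
  ⊖ a = (p ∸ 1) mod p ⊗ a

  ⊕-inverseˡ : ∀ a → ⊖ a ⊕ a ≡ 𝟘
  ⊕-inverseˡ a = represents-≡-mod (represents-⊕ (represents-⊗ (toℕ-mod (p ∸ 1)) (R a)) (R a)) represents-𝟘 (begin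
    ((p ∸ 1) * toℕ a + toℕ a) % p  ≡⟨ cong (_% p) (trans (+-comm _ (toℕ a)) (cong (_* toℕ a) (m+[n∸m]≡n (>-nonZero⁻¹ p)))) ⟩
    (p * toℕ a) % p                ≡⟨ cong (_% p) (*-comm p (toℕ a)) ⟩
    (toℕ a * p) % p                ≡⟨ m*n%n≡0 (toℕ a) p ⟩
    0                              ≡⟨ sym (m<n⇒m%n≡m (>-nonZero⁻¹ p)) ⟩
    0 % p                          ∎)
    where open ≡-Reasoning

  ⊕-inverseʳ : ∀ a → a ⊕ ⊖ a ≡ 𝟘
  ⊕-inverseʳ a = trans (⊕-comm a (⊖ a)) (⊕-inverseˡ a)

  ⊖-⊗ : ∀ a b → ⊖ a ⊗ b ≡ ⊖ (a ⊗ b)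
  ⊖-⊗ a b = ⊗-assoc ((p ∸ 1) mod p) a b

  ⊕-cancelˡ : ∀ c a b → c ⊕ a ≡ c ⊕ b → a ≡ b
  ⊕-cancelˡ c a b eq = begin
    a                ≡⟨ sym (⊕-identityˡ a) ⟩
    𝟘 ⊕ a            ≡⟨ cong (_⊕ a) (sym (⊕-inverseˡ c)) ⟩
    ⊖ c ⊕ c ⊕ a      ≡⟨ ⊕-assoc (⊖ c) c a ⟩
    ⊖ c ⊕ (c ⊕ a)    ≡⟨ cong (⊖ c ⊕_) eq ⟩
    ⊖ c ⊕ (c ⊕ b)    ≡⟨ sym (⊕-assoc (⊖ c) c b) ⟩
    ⊖ c ⊕ c ⊕ b      ≡⟨ cong (_⊕ b) (⊕-inverseˡ c) ⟩
    𝟘 ⊕ b            ≡⟨ ⊕-identityˡ b ⟩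
    b                ∎
    where open ≡-Reasoning

  a⊕⊖b≡𝟘⇒a≡b : ∀ a b → a ⊕ ⊖ b ≡ 𝟘 → a ≡ b
  a⊕⊖b≡𝟘⇒a≡b a b eq = ⊕-cancelˡ (⊖ b) a b (trans (⊕-comm (⊖ b) a) (trans eq (sym (⊕-inverseˡ b))))

  V : ℕ → Set
  V = Vecₚ p

  infixl 6 _+v_
  infixr 7 _·v_

  _+v_ : ∀ {n} → V n → V n → V n
  _+v_ = _+V_ p

  _·v_ : ∀ {n} → F p → V n → V n
  _·v_ = _·V_ p

  0v : ∀ {n} → V n
  0v = 0V p

  lookup-+v : ∀ {n} (x y : V n) k → lookup (x +v y) k ≡ lookup x k ⊕ lookup y k
  lookup-+v x y k = lookup-zipWith _⊕_ k x y

  lookup-·v : ∀ {n} c (x : V n) k → lookup (c ·v x) k ≡ c ⊗ lookup x k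
  lookup-·v c x k = lookup-map k (c ⊗_) x

  lookup-0v : ∀ {n} (k : Fin n) → lookup (0v {n}) k ≡ 𝟘
  lookup-0v k = lookup-replicate k 𝟘

  +v-comm : ∀ {n} (x y : V n) → x +v y ≡ y +v x
  +v-comm [] [] = refl
  +v-comm (a ∷ x) (b ∷ y) = cong₂ _∷_ (⊕-comm a b) (+v-comm x y)

  +v-assoc : ∀ {n} (x y z : V n) → x +v y +v z ≡ x +v (y +v z)
  +v-assoc [] [] [] = refl
  +v-assoc (a ∷ x) (b ∷ y) (c ∷ z) = cong₂ _∷_ (⊕-assoc a b c) (+v-assoc x y z)

  +v-identityˡ : ∀ {n} (x : V n) → 0v +v x ≡ x
  +v-identityˡ [] = refl
  +v-identityˡ (a ∷ x) = cong₂ _∷_ (⊕-identityˡ a) (+v-identityˡ x)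

  +v-identityʳ : ∀ {n} (x : V n) → x +v 0v ≡ x
  +v-identityʳ x = trans (+v-comm x 0v) (+v-identityˡ x)

  +v-interchange : ∀ {n} (a b c d : V n) → (a +v b) +v (c +v d) ≡ (a +v c) +v (b +v d)
  +v-interchange [] [] [] [] = refl
  +v-interchange (a ∷ as) (b ∷ bs) (c ∷ cs) (d ∷ ds) = cong₂ _∷_ (⊕-interchange a b c d) (+v-interchange as bs cs ds)

  ·v-distribˡ : ∀ {n} c (x y : V n) → c ·v (x +v y) ≡ c ·v x +v c ·v y
  ·v-distribˡ c [] [] = refl
  ·v-distribˡ c (a ∷ x) (b ∷ y) = cong₂ _∷_ (⊗-distribˡ-⊕ c a b) (·v-distribˡ c x y)

  ·v-distribʳ : ∀ {n} c d (x : V n) → (c ⊕ d) ·v x ≡ c ·v x +v d ·v x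
  ·v-distribʳ c d [] = refl
  ·v-distribʳ c d (a ∷ x) = cong₂ _∷_ (⊗-distribʳ-⊕ a c d) (·v-distribʳ c d x)

  ·v-assoc : ∀ {n} c d (x : V n) → (c ⊗ d) ·v x ≡ c ·v d ·v x
  ·v-assoc c d [] = refl
  ·v-assoc c d (a ∷ x) = cong₂ _∷_ (⊗-assoc c d a) (·v-assoc c d x)

  ·v-zeroʳ : ∀ {n} c → c ·v 0v {n} ≡ 0v
  ·v-zeroʳ {zero} c = refl
  ·v-zeroʳ {suc n} c = cong₂ _∷_ (⊗-zeroʳ c) (·v-zeroʳ c)

  ·v-zeroˡ : ∀ {n} (x : V n) → 𝟘 ·v x ≡ 0v
  ·v-zeroˡ [] = refl
  ·v-zeroˡ (a ∷ x) = cong₂ _∷_ (⊗-zeroˡ a) (·v-zeroˡ x)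

  ·v-identityˡ : ∀ {n} (x : V n) → 𝟙 ·v x ≡ x
  ·v-identityˡ [] = refl
  ·v-identityˡ (a ∷ x) = cong₂ _∷_ (⊗-identityˡ a) (·v-identityˡ x)

  lincomb-++ : ∀ {n} (cs ds : List (F p × V n)) → lincomb p (cs ++ ds) ≡ lincomb p cs +v lincomb p ds
  lincomb-++ [] ds = sym (+v-identityˡ _)
  lincomb-++ ((c , w) ∷ cs) ds = trans (cong (c ·v w +v_) (lincomb-++ cs ds)) (sym (+v-assoc (c ·v w) _ _))

  scaleCoefficients : ∀ {n} → F p → List (F p × V n) → List (F p × V n)
  scaleCoefficients d = List.map (λ (c , w) → d ⊗ c , w)

  lincomb-scale : ∀ {n} d (cs : List (F p × V n)) → lincomb p (scaleCoefficients d cs) ≡ d ·v lincomb p cs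
  lincomb-scale d [] = sym (·v-zeroʳ d)
  lincomb-scale d ((c , w) ∷ cs) = trans (cong₂ _+v_ (·v-assoc d c w) (lincomb-scale d cs)) (sym (·v-distribˡ d (c ·v w) _))

  module _ {n} {S : V n → Set} where

    span-0 : InSpan p S 0v
    span-0 = [] , [] , refl

    span-∈ : ∀ {w} → S w → InSpan p S w
    span-∈ {w} sw = (𝟙 , w) ∷ [] , sw ∷ [] , trans (+v-identityʳ (𝟙 ·v w)) (·v-identityˡ w)

    span-+ : ∀ {v w} → InSpan p S v → InSpan p S w → InSpan p S (v +v w)
    span-+ (cs , cs⊆S , refl) (ds , ds⊆S , refl) = cs ++ ds , All.++⁺ cs⊆S ds⊆S , lincomb-++ cs ds

    span-· : ∀ {v} c → InSpan p S v → InSpan p S (c ·v v)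
    span-· c (cs , cs⊆S , refl) = scaleCoefficients c cs , All.map⁺ cs⊆S , lincomb-scale c cs

    span-resp-≡ : ∀ {v w} → v ≡ w → InSpan p S v → InSpan p S w
    span-resp-≡ refl s = s

  span-map : ∀ {m n} {T : V m → Set} {S : V n → Set} (f : V m → V n) →
             f 0v ≡ 0v → (∀ c v w → f (c ·v v +v w) ≡ c ·v f v +v f w) →
             (∀ {w} → T w → InSpan p S (f w)) → ∀ {v} → InSpan p T v → InSpan p S (f v)
  span-map {T = T} {S} f f-0 f-linear f∈ (cs , cs⊆T , refl) = go cs cs⊆T
    where
    go : ∀ cs → All (λ cw → T (proj₂ cw)) cs → InSpan p S (f (lincomb p cs))
    go [] [] = span-resp-≡ (sym f-0) span-0
    go ((c , w) ∷ cs) (tw ∷ ts) = span-resp-≡ (sym (f-linear c w (lincomb p cs))) (span-+ (span-· c (f∈ tw)) (go cs ts))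

  span-mono : ∀ {n} {T S : V n → Set} → (∀ {w} → T w → InSpan p S w) → ∀ {v} → InSpan p T v → InSpan p S v
  span-mono = span-map (λ v → v) refl (λ _ _ _ → refl)

  infix 8 _∙_

  _∙_ : ∀ {n} → V n → V n → F p
  _∙_ = dot p

  ∙-comm : ∀ {n} (x y : V n) → x ∙ y ≡ y ∙ x
  ∙-comm [] [] = refl
  ∙-comm (a ∷ x) (b ∷ y) = cong₂ _⊕_ (⊗-comm a b) (∙-comm x y)

  ∙-zeroʳ : ∀ {n} (x : V n) → x ∙ 0v ≡ 𝟘
  ∙-zeroʳ [] = refl
  ∙-zeroʳ (a ∷ x) = trans (cong₂ _⊕_ (⊗-zeroʳ a) (∙-zeroʳ x)) (⊕-identityˡ 𝟘)

  ∙-zeroˡ : ∀ {n} (x : V n) → 0v ∙ x ≡ 𝟘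
  ∙-zeroˡ x = trans (∙-comm 0v x) (∙-zeroʳ x)

  ∙-distribˡ-+v : ∀ {n} (x y z : V n) → x ∙ (y +v z) ≡ x ∙ y ⊕ x ∙ z
  ∙-distribˡ-+v [] [] [] = sym (⊕-identityˡ 𝟘)
  ∙-distribˡ-+v (a ∷ x) (b ∷ y) (c ∷ z) =
    trans (cong₂ _⊕_ (⊗-distribˡ-⊕ a b c) (∙-distribˡ-+v x y z)) (⊕-interchange (a ⊗ b) (a ⊗ c) _ _)

  ∙-·v : ∀ {n} (x y : V n) c → x ∙ (c ·v y) ≡ c ⊗ (x ∙ y)
  ∙-·v [] [] c = sym (⊗-zeroʳ c)
  ∙-·v (a ∷ x) (b ∷ y) c = trans (cong₂ _⊕_ a[cb]≡c[ab] (∙-·v x y c)) (sym (⊗-distribˡ-⊕ c (a ⊗ b) (x ∙ y)))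
    where
    a[cb]≡c[ab] : a ⊗ (c ⊗ b) ≡ c ⊗ (a ⊗ b)
    a[cb]≡c[ab] = trans (sym (⊗-assoc a c b)) (trans (cong (_⊗ b) (⊗-comm a c)) (⊗-assoc c a b))

  ∙-span≡𝟘 : ∀ {n} {S : V n → Set} (x : V n) → (∀ {w} → S w → x ∙ w ≡ 𝟘) → ∀ {v} → InSpan p S v → x ∙ v ≡ 𝟘
  ∙-span≡𝟘 {S = S} x x⊥S (cs , cs⊆S , refl) = go cs cs⊆S
    where
    go : ∀ cs → All (λ cw → S (proj₂ cw)) cs → x ∙ lincomb p cs ≡ 𝟘
    go [] [] = ∙-zeroʳ x
    go ((c , w) ∷ cs) (sw ∷ ss) = begin
      x ∙ (c ·v w +v lincomb p cs)      ≡⟨ ∙-distribˡ-+v x (c ·v w) _ ⟩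
      x ∙ (c ·v w) ⊕ x ∙ lincomb p cs  ≡⟨ cong₂ _⊕_ (trans (∙-·v x w c) (trans (cong (c ⊗_) (x⊥S sw)) (⊗-zeroʳ c))) (go cs ss) ⟩
      𝟘 ⊕ 𝟘                            ≡⟨ ⊕-identityˡ 𝟘 ⟩
      𝟘                                ∎
      where open ≡-Reasoning

  unit : ∀ {n} → Fin n → V n
  unit = e p

  lookup-unit-≢ : ∀ {n} (j k : Fin n) → k ≢ j → lookup (unit j) k ≡ 𝟘
  lookup-unit-≢ j k k≢j with k ≟ j | lookup∘tabulate (λ i → if ⌊ i ≟ j ⌋ then 𝟙 else 𝟘) k
  ... | yes k≡j | _ = ⊥-elim (k≢j k≡j)
  ... | no _ | eq = eq

  lookup-unit-≡ : ∀ {n} (j : Fin n) → lookup (unit j) j ≡ 𝟙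
  lookup-unit-≡ j with j ≟ j | lookup∘tabulate (λ i → if ⌊ i ≟ j ⌋ then 𝟙 else 𝟘) j
  ... | yes _ | eq = eq
  ... | no j≢j | _ = ⊥-elim (j≢j refl)

  unit-zero : ∀ {n} → unit {suc n} fzero ≡ 𝟙 ∷ 0v
  unit-zero = cong (𝟙 ∷_) (tabulate-const _)
    where
    tabulate-const : ∀ n → tabulate {n = n} (λ _ → 𝟘) ≡ 0v
    tabulate-const zero = refl
    tabulate-const (suc n) = cong (𝟘 ∷_) (tabulate-const n)

  unit-suc : ∀ {n} (k : Fin n) → unit (fsuc k) ≡ 𝟘 ∷ unit k
  unit-suc k = cong (𝟘 ∷_) (tabulate-cong λ j →
    cong (if_then 𝟙 else 𝟘) (trans (isYes≗does (fsuc j ≟ fsuc k)) (sym (isYes≗does (j ≟ k)))))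

  ∙-unit : ∀ {n} (x : V n) k → x ∙ unit k ≡ lookup x k
  ∙-unit (a ∷ x) fzero = begin
    (a ∷ x) ∙ unit fzero  ≡⟨ cong ((a ∷ x) ∙_) unit-zero ⟩
    a ⊗ 𝟙 ⊕ x ∙ 0v        ≡⟨ cong₂ _⊕_ (⊗-identityʳ a) (∙-zeroʳ x) ⟩
    a ⊕ 𝟘                 ≡⟨ ⊕-identityʳ a ⟩
    a                     ∎
    where open ≡-Reasoning
  ∙-unit (a ∷ x) (fsuc k) = begin
    (a ∷ x) ∙ unit (fsuc k)  ≡⟨ cong ((a ∷ x) ∙_) (unit-suc k) ⟩
    a ⊗ 𝟘 ⊕ x ∙ unit k       ≡⟨ cong₂ _⊕_ (⊗-zeroʳ a) (∙-unit x k) ⟩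
    𝟘 ⊕ lookup x k           ≡⟨ ⊕-identityˡ _ ⟩
    lookup x k               ∎
    where open ≡-Reasoning

  module _ {n : ℕ} where

    private
      shiftBound : ∀ a {m} → a + suc m ≤ n → suc a + m ≤ n
      shiftBound a {m} pf = ≤-trans (≤-reflexive (sym (+-suc a m))) pf

      slot : ∀ a {m} → a + suc m ≤ n → Fin n
      slot a {m} pf = fromℕ< (≤-trans (s≤s (m≤m+n a m)) (shiftBound a pf))

      toℕ-slot : ∀ a {m} (pf : a + suc m ≤ n) → toℕ (slot a pf) ≡ a
      toℕ-slot a pf = toℕ-fromℕ< _

    blockTerms : ∀ {m} a → V m → a + m ≤ n → List (F p × V n)
    blockTerms a [] _ = []
    blockTerms a (x ∷ xs) pf = (x , unit (slot a pf)) ∷ blockTerms (suc a) xs (shiftBound a pf)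

    embed : ∀ {m} a → V m → a + m ≤ n → V n
    embed a x pf = lincomb p (blockTerms a x pf)

    embed-0v : ∀ {m} a (pf : a + m ≤ n) → embed a 0v pf ≡ 0v
    embed-0v {zero} a pf = refl
    embed-0v {suc m} a pf = trans (cong₂ _+v_ (·v-zeroˡ _) (embed-0v (suc a) (shiftBound a pf))) (+v-identityˡ 0v)

    embed-linear : ∀ {m} a c (x y : V m) (pf : a + m ≤ n) → embed a (c ·v x +v y) pf ≡ c ·v embed a x pf +v embed a y pf
    embed-linear a c [] [] pf = sym (trans (+v-identityʳ _) (·v-zeroʳ c))
    embed-linear a c (x ∷ xs) (y ∷ ys) pf = begin
      (c ⊗ x ⊕ y) ·v u +v embed (suc a) (c ·v xs +v ys) pf′          ≡⟨ cong₂ _+v_ (·v-distribʳ (c ⊗ x) y u) (embed-linear (suc a) c xs ys pf′) ⟩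
      ((c ⊗ x) ·v u +v y ·v u) +v (c ·v X +v Y)                       ≡⟨ +v-interchange _ _ _ _ ⟩
      ((c ⊗ x) ·v u +v c ·v X) +v (y ·v u +v Y)                       ≡⟨ cong (_+v (y ·v u +v Y)) (trans (cong (_+v c ·v X) (·v-assoc c x u)) (sym (·v-distribˡ c (x ·v u) X))) ⟩
      c ·v (x ·v u +v X) +v (y ·v u +v Y)                             ∎
      where
      open ≡-Reasoning
      u = unit (slot a pf)
      pf′ = shiftBound a pf
      X = embed (suc a) xs pf′
      Y = embed (suc a) ys pf′

    lookup-embed-< : ∀ {m} a (x : V m) pf (k : Fin n) → toℕ k < a → lookup (embed a x pf) k ≡ 𝟘
    lookup-embed-< a [] pf k k<a = lookup-0v k
    lookup-embed-< a (x ∷ xs) pf k k<a = begin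
      lookup (x ·v u +v embed (suc a) xs pf′) k  ≡⟨ lookup-+v (x ·v u) _ k ⟩
      lookup (x ·v u) k ⊕ lookup (embed (suc a) xs pf′) k
        ≡⟨ cong₂ _⊕_ (trans (lookup-·v x u k) (cong (x ⊗_) (lookup-unit-≢ _ k k≢slot))) (lookup-embed-< (suc a) xs pf′ k (m<n⇒m<1+n k<a)) ⟩
      x ⊗ 𝟘 ⊕ 𝟘                                  ≡⟨ trans (⊕-identityʳ _) (⊗-zeroʳ x) ⟩
      𝟘                                          ∎
      where
      open ≡-Reasoning
      u = unit (slot a pf)
      pf′ = shiftBound a pf
      k≢slot : k ≢ slot a pf
      k≢slot refl = <-irrefl (toℕ-slot a pf) k<a

    lookup-embed : ∀ {m} a (x : V m) pf (j : Fin m) (k : Fin n) → toℕ k ≡ a + toℕ j → lookup (embed a x pf) k ≡ lookup x j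
    lookup-embed a (x ∷ xs) pf fzero k k≡a+0 = begin
      lookup (x ·v u +v embed (suc a) xs pf′) k  ≡⟨ lookup-+v (x ·v u) _ k ⟩
      lookup (x ·v u) k ⊕ lookup (embed (suc a) xs pf′) k
        ≡⟨ cong₂ _⊕_ (trans (lookup-·v x u k) (cong (x ⊗_) (trans (cong (lookup u) k≡slot) (lookup-unit-≡ (slot a pf)))))
                     (lookup-embed-< (suc a) xs pf′ k (s≤s (≤-reflexive (trans k≡a+0 (+-identityʳ a))))) ⟩
      x ⊗ 𝟙 ⊕ 𝟘                                  ≡⟨ trans (⊕-identityʳ _) (⊗-identityʳ x) ⟩
      x                                          ∎
      where
      open ≡-Reasoning
      u = unit (slot a pf)
      pf′ = shiftBound a pf
      k≡slot : k ≡ slot a pf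
      k≡slot = toℕ-injective (trans k≡a+0 (trans (+-identityʳ a) (sym (toℕ-slot a pf))))
    lookup-embed a (x ∷ xs) pf (fsuc j) k k≡a+1+j = begin
      lookup (x ·v u +v embed (suc a) xs pf′) k  ≡⟨ lookup-+v (x ·v u) _ k ⟩
      lookup (x ·v u) k ⊕ lookup (embed (suc a) xs pf′) k
        ≡⟨ cong₂ _⊕_ (trans (lookup-·v x u k) (cong (x ⊗_) (lookup-unit-≢ _ k k≢slot))) (lookup-embed (suc a) xs pf′ j k (trans k≡a+1+j (+-suc a (toℕ j)))) ⟩
      x ⊗ 𝟘 ⊕ lookup xs j                        ≡⟨ trans (cong (_⊕ _) (⊗-zeroʳ x)) (⊕-identityˡ _) ⟩
      lookup xs j                                ∎
      where
      open ≡-Reasoning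
      u = unit (slot a pf)
      pf′ = shiftBound a pf
      k≢slot : k ≢ slot a pf
      k≢slot refl = <-irrefl (trans (sym (toℕ-slot a pf)) k≡a+1+j) (m<m+n a (s≤s z≤n))

    embed-unit : ∀ {m} a (j : Fin m) pf (k : Fin n) → toℕ k ≡ a + toℕ j → embed a (unit j) pf ≡ unit k
    embed-unit {suc m} a fzero pf k k≡a+0 = begin
      embed a (unit fzero) pf                   ≡⟨ cong (λ v → embed a v pf) unit-zero ⟩
      𝟙 ·v unit (slot a pf) +v embed (suc a) 0v (shiftBound a pf) ≡⟨ cong₂ _+v_ (·v-identityˡ _) (embed-0v {m} (suc a) _) ⟩
      unit (slot a pf) +v 0v                    ≡⟨ +v-identityʳ _ ⟩
      unit (slot a pf)                          ≡⟨ cong unit (toℕ-injective (trans (toℕ-slot a pf) (sym (trans k≡a+0 (+-identityʳ a))))) ⟩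
      unit k                                    ∎
      where open ≡-Reasoning
    embed-unit a (fsuc j) pf k k≡a+1+j = begin
      embed a (unit (fsuc j)) pf                ≡⟨ cong (λ v → embed a v pf) (unit-suc j) ⟩
      𝟘 ·v unit (slot a pf) +v embed (suc a) (unit j) (shiftBound a pf) ≡⟨ cong₂ _+v_ (·v-zeroˡ _) (embed-unit (suc a) j _ k (trans k≡a+1+j (+-suc a (toℕ j)))) ⟩
      0v +v unit k                              ≡⟨ +v-identityˡ _ ⟩
      unit k                                    ∎
      where open ≡-Reasoning

    blockTerms⊆Es : ∀ {m} a′ a (x : V m) pf → a′ ≤ a → All (λ cw → Es p a′ (a + m) (proj₂ cw)) (blockTerms a x pf)
    blockTerms⊆Es a′ a [] pf a′≤a = []
    blockTerms⊆Es {suc m} a′ a (x ∷ xs) pf a′≤a =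
      (slot a pf , (subst (a′ ≤_) (sym (toℕ-slot a pf)) a′≤a , subst (_< a + suc m) (sym (toℕ-slot a pf)) (m<m+n a (s≤s z≤n))) , refl)
      ∷ subst (λ b → All (λ cw → Es p a′ b (proj₂ cw)) (blockTerms (suc a) xs (shiftBound a pf))) (sym (+-suc a m))
              (blockTerms⊆Es a′ (suc a) xs (shiftBound a pf) (m≤n⇒m≤1+n a′≤a))

  VanishesFrom : ∀ {n} → ℕ → V n → Set
  VanishesFrom a u = ∀ k → a ≤ toℕ k → lookup u k ≡ 𝟘

  encode : ∀ {n} a → V n → Fin (p ^ a)
  encode zero _ = fzero
  encode (suc a) [] = combine 𝟘 (encode a (Vec.[] {A = F p}))
  encode (suc a) (x ∷ xs) = combine x (encode a xs)

  encode-injective : ∀ {n} a {u u′ : V n} → VanishesFrom a u → VanishesFrom a u′ → encode a u ≡ encode a u′ → u ≡ u′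
  encode-injective zero {[]} {[]} _ _ _ = refl
  encode-injective zero {x ∷ u} {x′ ∷ u′} u↓ u′↓ _ =
    cong₂ _∷_ (trans (u↓ fzero z≤n) (sym (u′↓ fzero z≤n)))
              (encode-injective zero (λ k _ → u↓ (fsuc k) z≤n) (λ k _ → u′↓ (fsuc k) z≤n) refl)
  encode-injective (suc a) {[]} {[]} _ _ _ = refl
  encode-injective (suc a) {x ∷ u} {x′ ∷ u′} u↓ u′↓ eq with combine-injective x (encode a u) x′ (encode a u′) eq
  ... | x≡x′ , eq′ = cong₂ _∷_ x≡x′ (encode-injective a (λ k a≤k → u↓ (fsuc k) (s≤s a≤k)) (λ k a≤k → u′↓ (fsuc k) (s≤s a≤k)) eq′)

  isZero : F p → ℕ
  isZero x = if ⌊ x ≟ 𝟘 ⌋ then 1 else 0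

  isZero-≢ : ∀ {x} → x ≢ 𝟘 → isZero x ≡ 0
  isZero-≢ {x} x≢𝟘 with x ≟ 𝟘
  ... | yes x≡𝟘 = ⊥-elim (x≢𝟘 x≡𝟘)
  ... | no _ = refl

  isZero-cases : ∀ x → (x ≡ 𝟘 × isZero x ≡ 1) ⊎ (x ≢ 𝟘 × isZero x ≡ 0)
  isZero-cases x with x ≟ 𝟘
  ... | yes x≡𝟘 = inj₁ (x≡𝟘 , refl)
  ... | no x≢𝟘 = inj₂ (x≢𝟘 , refl)

  zeros : ∀ {N} → V N → ℕ
  zeros [] = 0
  zeros (x ∷ v) = isZero x + zeros v

  zeros-replicate : ∀ N {b} → b ≢ 𝟘 → zeros (replicate N b) ≡ 0
  zeros-replicate zero b≢𝟘 = refl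
  zeros-replicate (suc N) b≢𝟘 = cong₂ _+_ (isZero-≢ b≢𝟘) (zeros-replicate N b≢𝟘)

  zeros≤1 : ∀ {N} (v : V N) → (∀ {s t} → lookup v s ≡ 𝟘 → lookup v t ≡ 𝟘 → s ≡ t) → zeros v ≤ 1
  zeros≤1 [] _ = z≤n
  zeros≤1 (x ∷ v) one-zero with isZero-cases x
  ... | inj₁ (x≡𝟘 , isZero≡1) rewrite isZero≡1 = ≤-reflexive (cong suc (no-zeros v (λ t vt≡𝟘 → fzero≢fsuc (one-zero x≡𝟘 vt≡𝟘))))
    where
    fzero≢fsuc : ∀ {N} {t : Fin N} → fzero ≢ fsuc t
    fzero≢fsuc ()
    no-zeros : ∀ {M} (w : V M) → (∀ t → lookup w t ≢ 𝟘) → zeros w ≡ 0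
    no-zeros [] _ = refl
    no-zeros (y ∷ w) w≢𝟘 = cong₂ _+_ (isZero-≢ (w≢𝟘 fzero)) (no-zeros w (λ t → w≢𝟘 (fsuc t)))
  ... | inj₂ (_ , isZero≡0) rewrite isZero≡0 = zeros≤1 v (λ vs≡𝟘 vt≡𝟘 → fsuc-injective (one-zero vs≡𝟘 vt≡𝟘))

  zeroPositions : ∀ {N} → V N → List (Fin N)
  zeroPositions [] = []
  zeroPositions (x ∷ v) with x ≟ 𝟘
  ... | yes _ = fzero ∷ List.map fsuc (zeroPositions v)
  ... | no _ = List.map fsuc (zeroPositions v)

  length-zeroPositions : ∀ {N} (v : V N) → length (zeroPositions v) ≡ zeros v
  length-zeroPositions [] = refl
  length-zeroPositions (x ∷ v) with x ≟ 𝟘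
  ... | yes _ = cong suc (trans (List.length-map fsuc (zeroPositions v)) (length-zeroPositions v))
  ... | no _ = trans (List.length-map fsuc (zeroPositions v)) (length-zeroPositions v)

  ∈-zeroPositions : ∀ {N} (v : V N) {t} → lookup v t ≡ 𝟘 → t ∈ zeroPositions v
  ∈-zeroPositions (x ∷ v) {t} vt≡𝟘 with x ≟ 𝟘 | t
  ... | yes _ | fzero = here refl
  ... | yes _ | fsuc t′ = there (Membership.∈-map⁺ fsuc (∈-zeroPositions v vt≡𝟘))
  ... | no x≢𝟘 | fzero = ⊥-elim (x≢𝟘 vt≡𝟘)
  ... | no _ | fsuc t′ = Membership.∈-map⁺ fsuc (∈-zeroPositions v vt≡𝟘)

  unique-zeros≤zeros : ∀ {N} (v : V N) (ts : List (Fin N)) → Unique ts → All (λ t → lookup v t ≡ 𝟘) ts → length ts ≤ zeros v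
  unique-zeros≤zeros v ts uts ts-zero = subst (length ts ≤_) (length-zeroPositions v)
    (unique⊆⇒length≤ ts (zeroPositions v) uts (All.map (∈-zeroPositions v) ts-zero))

  vectors : ∀ N → List (V N)
  vectors zero = [] ∷ []
  vectors (suc N) = concatMap (λ x → List.map (x ∷_) (vectors N)) (allFin p)

  length-vectors : ∀ N → length (vectors N) ≡ p ^ N
  length-vectors zero = refl
  length-vectors (suc N) = trans (length-concatMap (allFin p)) (cong₂ _*_ (List.length-tabulate {n = p} (λ i → i)) (length-vectors N))
    where
    length-concatMap : ∀ xs → length (concatMap (λ x → List.map (x ∷_) (vectors N)) xs) ≡ length xs * length (vectors N)
    length-concatMap [] = refl
    length-concatMap (x ∷ xs) = trans (List.length-++ (List.map (x ∷_) (vectors N)))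
      (cong₂ _+_ (List.length-map (x ∷_) (vectors N)) (length-concatMap xs))

  ∈-vectors : ∀ {N} (v : V N) → v ∈ vectors N
  ∈-vectors [] = here refl
  ∈-vectors (x ∷ v) = Membership.∈-concat⁺′ (Membership.∈-map⁺ (x ∷_) (∈-vectors v)) (Membership.∈-map⁺ _ (Membership.∈-allFin x))

  sumBy-vectors-suc : ∀ N (f : V (suc N) → ℕ) → sumBy (vectors (suc N)) f ≡ sumBy (allFin p) (λ x → sumBy (vectors N) (λ v → f (x ∷ v)))
  sumBy-vectors-suc N f = trans (sumBy-concatMap _ (allFin p) f) (sumBy-cong (allFin p) (λ x → sumBy-map (x ∷_) (vectors N) f))

  module _ (prime-p : Prime p) where

    1<p : 1 < p
    1<p = prime⇒1<p prime-p
      where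
      prime⇒1<p : Prime p → 1 < p
      prime⇒1<p (prime _) = nonTrivial⇒n>1 p

    𝟘≢𝟙 : 𝟘 ≢ 𝟙
    𝟘≢𝟙 𝟘≡𝟙 with trans (sym toℕ-𝟘) (trans (cong toℕ 𝟘≡𝟙) (trans (toℕ-mod 1) (m<n⇒m%n≡m 1<p)))
    ... | ()

    ⊗-inverse : ∀ a → a ≢ 𝟘 → ∃ λ b → b ⊗ a ≡ 𝟙
    ⊗-inverse a a≢𝟘 = fromBézout (coprime-Bézout (prime⇒coprime prime-p {{≢-nonZero toℕa≢0}} (toℕ<n a)))
      where
      toℕa≢0 : toℕ a ≢ 0
      toℕa≢0 eq = a≢𝟘 (toℕ-injective (trans eq (sym toℕ-𝟘)))
      -- Bézout gives 1 + y a = x p or y a = 1 + x p; in the first case the inverse is -y = (p - 1) y.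
      fromBézout : GCD.Bézout.Identity 1 p (toℕ a) → ∃ λ b → b ⊗ a ≡ 𝟙
      fromBézout (GCD.Bézout.-+ x y eq) = y mod p , represents-≡-mod (represents-⊗ (toℕ-mod y) (represents-toℕ a)) represents-𝟙
        (trans (cong (_% p) (sym eq)) ([m+kn]%n≡m%n 1 x p))
      fromBézout (GCD.Bézout.+- x y eq) =
        ⊖ (y mod p) , represents-≡-mod (represents-⊗ (represents-⊗ (toℕ-mod (p ∸ 1)) (toℕ-mod y)) (represents-toℕ a)) represents-𝟙
          (trans (sym ([m+kn]%n≡m%n Q 1 p)) (trans (cong (_% p) Q+p≡1+[[p-1]x]p) ([m+kn]%n≡m%n 1 ((p ∸ 1) * x) p)))
        where
        Q = (p ∸ 1) * y * toℕ a
        Q+p≡1+[[p-1]x]p : Q + 1 * p ≡ 1 + (p ∸ 1) * x * p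
        Q+p≡1+[[p-1]x]p = begin
          Q + 1 * p                       ≡⟨ cong (Q +_) (trans (+-identityʳ p) (sym (trans (+-comm (p ∸ 1) 1) (m+[n∸m]≡n (>-nonZero⁻¹ p))))) ⟩
          Q + (p ∸ 1 + 1)                 ≡⟨ regroup (p ∸ 1) y (toℕ a) ⟩
          (p ∸ 1) * (1 + y * toℕ a) + 1   ≡⟨ cong (λ z → (p ∸ 1) * z + 1) eq ⟩
          (p ∸ 1) * (x * p) + 1           ≡⟨ regroup′ (p ∸ 1) x p ⟩
          1 + (p ∸ 1) * x * p             ∎
          where
          open ≡-Reasoning
          regroup : ∀ c y t → c * y * t + (c + 1) ≡ c * (1 + y * t) + 1
          regroup = solve-∀
          regroup′ : ∀ c x p → c * (x * p) + 1 ≡ 1 + c * x * p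
          regroup′ = solve-∀

    ⊗-cancelˡ : ∀ c a b → c ≢ 𝟘 → c ⊗ a ≡ c ⊗ b → a ≡ b
    ⊗-cancelˡ c a b c≢𝟘 eq with ⊗-inverse c c≢𝟘
    ... | c⁻¹ , c⁻¹c≡𝟙 = begin
      a                ≡⟨ sym (⊗-identityˡ a) ⟩
      𝟙 ⊗ a            ≡⟨ cong (_⊗ a) (sym c⁻¹c≡𝟙) ⟩
      c⁻¹ ⊗ c ⊗ a      ≡⟨ ⊗-assoc c⁻¹ c a ⟩
      c⁻¹ ⊗ (c ⊗ a)    ≡⟨ cong (c⁻¹ ⊗_) eq ⟩
      c⁻¹ ⊗ (c ⊗ b)    ≡⟨ sym (⊗-assoc c⁻¹ c b) ⟩
      c⁻¹ ⊗ c ⊗ b      ≡⟨ cong (_⊗ b) c⁻¹c≡𝟙 ⟩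
      𝟙 ⊗ b            ≡⟨ ⊗-identityˡ b ⟩
      b                ∎
      where open ≡-Reasoning

    affine-injective : ∀ λ′ c {x y} → λ′ ≢ 𝟘 → λ′ ⊗ x ⊕ c ≡ 𝟘 → λ′ ⊗ y ⊕ c ≡ 𝟘 → x ≡ y
    affine-injective λ′ c {x} {y} λ′≢𝟘 x-root y-root =
      ⊗-cancelˡ λ′ x y λ′≢𝟘 (⊕-cancelˡ c _ _ (trans (⊕-comm c _) (trans x-root (trans (sym y-root) (⊕-comm _ c)))))


    Annihilator : ∀ {m} → List (V m) → Set
    Annihilator S = ∃ λ β → β ≢ 0v × All (λ s → β ∙ s ≡ 𝟘) S

    SpansAll : ∀ {m} → List (V m) → Set
    SpansAll S = ∀ v → InSpan p (_∈ S) v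

    -- Subtracting multiples of a pivot s* = h* ∷ t* (with μ h* = 𝟙) clears the first coordinate of every member of S.
    module Pivot {m} (S : List (V (suc m))) {h* t*} (s*∈S : (h* ∷ t*) ∈ S) {μ} (μh*≡𝟙 : μ ⊗ h* ≡ 𝟙) where

      clearHead : V (suc m) → V m
      clearHead (h ∷ t) = t +v ⊖ (h ⊗ μ) ·v t*

      cleared : List (V m)
      cleared = List.map clearHead S

      [hμ]h*≡h : ∀ h → h ⊗ μ ⊗ h* ≡ h
      [hμ]h*≡h h = trans (⊗-assoc h μ h*) (trans (cong (h ⊗_) μh*≡𝟙) (⊗-identityʳ h))

      𝟘∷cleared∈span : ∀ {w} → w ∈ cleared → InSpan p (_∈ S) (𝟘 ∷ w)
      𝟘∷cleared∈span w∈ with Membership.∈-map⁻ clearHead w∈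
      ... | h ∷ t , s∈S , refl = span-resp-≡ (cong (_∷ _) head-cleared) (span-+ (span-∈ s∈S) (span-· (⊖ (h ⊗ μ)) (span-∈ s*∈S)))
        where
        head-cleared : h ⊕ ⊖ (h ⊗ μ) ⊗ h* ≡ 𝟘
        head-cleared = trans (cong (h ⊕_) (trans (⊖-⊗ (h ⊗ μ) h*) (cong ⊖_ ([hμ]h*≡h h)))) (⊕-inverseʳ h)

      span-𝟘∷ : ∀ {v} → InSpan p (_∈ cleared) v → InSpan p (_∈ S) (𝟘 ∷ v)
      span-𝟘∷ = span-map (𝟘 ∷_) refl (λ c v w → cong (_∷ (c ·v v +v w)) (sym (trans (cong (_⊕ 𝟘) (⊗-zeroʳ c)) (⊕-identityˡ 𝟘)))) 𝟘∷cleared∈span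

      spansAll : SpansAll cleared → SpansAll S
      spansAll cleared-spans (x ∷ v) = span-resp-≡ (cong₂ _∷_ head-eq tail-eq)
          (span-+ (span-𝟘∷ (cleared-spans (v +v ⊖ (x ⊗ μ) ·v t*))) (span-· (x ⊗ μ) (span-∈ s*∈S)))
        where
        head-eq : 𝟘 ⊕ x ⊗ μ ⊗ h* ≡ x
        head-eq = trans (⊕-identityˡ _) ([hμ]h*≡h x)
        tail-eq : v +v ⊖ (x ⊗ μ) ·v t* +v (x ⊗ μ) ·v t* ≡ v
        tail-eq = begin
          v +v ⊖ (x ⊗ μ) ·v t* +v (x ⊗ μ) ·v t*   ≡⟨ +v-assoc v _ _ ⟩
          v +v (⊖ (x ⊗ μ) ·v t* +v (x ⊗ μ) ·v t*) ≡⟨ cong (v +v_) (sym (·v-distribʳ (⊖ (x ⊗ μ)) (x ⊗ μ) t*)) ⟩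
          v +v (⊖ (x ⊗ μ) ⊕ x ⊗ μ) ·v t*          ≡⟨ cong (λ c → v +v c ·v t*) (⊕-inverseˡ (x ⊗ μ)) ⟩
          v +v 𝟘 ·v t*                            ≡⟨ trans (cong (v +v_) (·v-zeroˡ t*)) (+v-identityʳ v) ⟩
          v                                       ∎
          where open ≡-Reasoning

      annihilator : Annihilator cleared → Annihilator S
      annihilator (β′ , β′≢0 , β′⊥cleared) = ⊖ (μ ⊗ b) ∷ β′ , (λ eq → β′≢0 (∷-injectiveʳ eq)) , All.map (λ {s} → ⊥S s) (All.map⁻ β′⊥cleared)
        where
        b = β′ ∙ t*
        ⊥S : ∀ s → β′ ∙ clearHead s ≡ 𝟘 → (⊖ (μ ⊗ b) ∷ β′) ∙ s ≡ 𝟘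
        ⊥S (h ∷ t) β′⊥ = begin
          ⊖ (μ ⊗ b) ⊗ h ⊕ β′ ∙ t   ≡⟨ cong₂ _⊕_ (trans (⊖-⊗ (μ ⊗ b) h) (cong ⊖_ μBh≡hμb)) β′∙t≡hμb ⟩
          ⊖ (h ⊗ μ ⊗ b) ⊕ h ⊗ μ ⊗ b ≡⟨ ⊕-inverseˡ _ ⟩
          𝟘                         ∎
          where
          open ≡-Reasoning
          μBh≡hμb : μ ⊗ b ⊗ h ≡ h ⊗ μ ⊗ b
          μBh≡hμb = trans (⊗-comm (μ ⊗ b) h) (sym (⊗-assoc h μ b))
          β′∙t≡hμb : β′ ∙ t ≡ h ⊗ μ ⊗ b
          β′∙t≡hμb = a⊕⊖b≡𝟘⇒a≡b _ _ (begin
            β′ ∙ t ⊕ ⊖ (h ⊗ μ ⊗ b)        ≡⟨ cong (β′ ∙ t ⊕_) (sym (⊖-⊗ (h ⊗ μ) b)) ⟩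
            β′ ∙ t ⊕ ⊖ (h ⊗ μ) ⊗ b        ≡⟨ cong (β′ ∙ t ⊕_) (sym (∙-·v β′ t* (⊖ (h ⊗ μ)))) ⟩
            β′ ∙ t ⊕ β′ ∙ (⊖ (h ⊗ μ) ·v t*) ≡⟨ sym (∙-distribˡ-+v β′ t _) ⟩
            β′ ∙ clearHead (h ∷ t)        ≡⟨ β′⊥ ⟩
            𝟘                             ∎)

    nonzeroHead⊎allHeads𝟘 : ∀ {m} (S : List (V (suc m))) → (∃ λ h → ∃ λ t → (h ∷ t) ∈ S × h ≢ 𝟘) ⊎ All (λ (s : V (suc m)) → Vec.head s ≡ 𝟘) S
    nonzeroHead⊎allHeads𝟘 [] = inj₂ []
    nonzeroHead⊎allHeads𝟘 ((h ∷ t) ∷ S) with h ≟ 𝟘 | nonzeroHead⊎allHeads𝟘 S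
    ... | no h≢𝟘 | _ = inj₁ (h , t , here refl , h≢𝟘)
    ... | yes _ | inj₁ (h′ , t′ , s∈S , h′≢𝟘) = inj₁ (h′ , t′ , there s∈S , h′≢𝟘)
    ... | yes h≡𝟘 | inj₂ heads𝟘 = inj₂ (h≡𝟘 ∷ heads𝟘)

    spansAll⊎annihilator : ∀ m (S : List (V m)) → SpansAll S ⊎ Annihilator S
    spansAll⊎annihilator zero S = inj₁ λ { [] → span-0 }
    spansAll⊎annihilator (suc m) S with nonzeroHead⊎allHeads𝟘 S
    ... | inj₂ heads𝟘 = inj₂ (𝟙 ∷ 0v , (λ eq → 𝟘≢𝟙 (sym (∷-injectiveˡ eq))) , All.map (λ {s} → e₁⊥ s) heads𝟘)
      where
      e₁⊥ : ∀ s → Vec.head s ≡ 𝟘 → (𝟙 ∷ 0v) ∙ s ≡ 𝟘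
      e₁⊥ (h ∷ t) h≡𝟘 = trans (cong₂ _⊕_ (trans (⊗-identityˡ h) h≡𝟘) (∙-zeroˡ t)) (⊕-identityˡ 𝟘)
    ... | inj₁ (h* , t* , s*∈S , h*≢𝟘) with ⊗-inverse h* h*≢𝟘
    ...   | μ , μh*≡𝟙 with spansAll⊎annihilator m (Pivot.cleared S {h*} {t*} s*∈S {μ} μh*≡𝟙)
    ...     | inj₁ spans = inj₁ (Pivot.spansAll S {h*} {t*} s*∈S {μ} μh*≡𝟙 spans)
    ...     | inj₂ ann = inj₂ (Pivot.annihilator S {h*} {t*} s*∈S {μ} μh*≡𝟙 ann)

    -- 3^[y = 0] is 3 at the single root and 1 elsewhere.
    sum-3^isZero-affine≤p+2 : ∀ λ′ c → λ′ ≢ 𝟘 → sumBy (allFin p) (λ x → 3 ^ isZero (λ′ ⊗ x ⊕ c)) ≤ p + 2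
    sum-3^isZero-affine≤p+2 λ′ c λ′≢𝟘 = subst (λ l → sumBy (allFin p) g ≤ l + 2) (List.length-tabulate {n = p} (λ i → i))
      (weight≤ (allFin p) (Unique.allFin⁺ p))
      where
      g = λ x → 3 ^ isZero (λ′ ⊗ x ⊕ c)
      weight≤ : ∀ xs → Unique xs → sumBy xs g ≤ length xs + 2
      weight≤ [] _ = z≤n
      weight≤ (x ∷ xs) (x∉xs ∷ uxs) with isZero-cases (λ′ ⊗ x ⊕ c)
      ... | inj₂ (_ , isZero≡0) rewrite isZero≡0 = s≤s (weight≤ xs uxs)
      ... | inj₁ (x-root , isZero≡1) rewrite isZero≡1 = ≤-reflexive (trans (cong (3 +_) (no-other-root xs x∉xs)) (cong suc (+-comm 2 (length xs))))
        where
        no-other-root : ∀ ys → All (x ≢_) ys → sumBy ys g ≡ length ys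
        no-other-root [] [] = refl
        no-other-root (y ∷ ys) (x≢y ∷ x≢ys) =
          cong₂ _+_ (cong (3 ^_) (isZero-≢ (λ y-root → x≢y (affine-injective λ′ c λ′≢𝟘 x-root y-root)))) (no-other-root ys x≢ys)

    -- The exponential moment of the number of zeros factorises over the coordinates of ρ.
    sum-3^zeros-affine≤ : ∀ N λ′ (c : V N) → λ′ ≢ 𝟘 → sumBy (vectors N) (λ ρ → 3 ^ zeros (λ′ ·v ρ +v c)) ≤ (p + 2) ^ N
    sum-3^zeros-affine≤ zero λ′ [] _ = ≤-refl
    sum-3^zeros-affine≤ (suc N) λ′ (c₀ ∷ c) λ′≢𝟘 = begin
      sumBy (vectors (suc N)) (λ ρ → 3 ^ zeros (λ′ ·v ρ +v (c₀ ∷ c)))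
        ≡⟨ sumBy-vectors-suc N _ ⟩
      sumBy (allFin p) (λ x → sumBy (vectors N) (λ ρ → 3 ^ (isZero (λ′ ⊗ x ⊕ c₀) + zeros (λ′ ·v ρ +v c))))
        ≡⟨ sumBy-cong (allFin p) (λ x → trans (sumBy-cong (vectors N) (λ ρ → ^-distribˡ-+-* 3 (isZero (λ′ ⊗ x ⊕ c₀)) _)) (sumBy-*ˡ (vectors N) (3 ^ isZero (λ′ ⊗ x ⊕ c₀)) (λ ρ → 3 ^ zeros (λ′ ·v ρ +v c)))) ⟩
      sumBy (allFin p) (λ x → 3 ^ isZero (λ′ ⊗ x ⊕ c₀) * sumBy (vectors N) (λ ρ → 3 ^ zeros (λ′ ·v ρ +v c)))
        ≤⟨ sumBy-mono-≤ (allFin p) (λ x → *-monoʳ-≤ (3 ^ isZero (λ′ ⊗ x ⊕ c₀)) (sum-3^zeros-affine≤ N λ′ c λ′≢𝟘)) ⟩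
      sumBy (allFin p) (λ x → 3 ^ isZero (λ′ ⊗ x ⊕ c₀) * (p + 2) ^ N)
        ≡⟨ trans (sumBy-cong (allFin p) (λ x → *-comm (3 ^ isZero (λ′ ⊗ x ⊕ c₀)) _)) (sumBy-*ˡ (allFin p) ((p + 2) ^ N) (λ x → 3 ^ isZero (λ′ ⊗ x ⊕ c₀))) ⟩
      (p + 2) ^ N * sumBy (allFin p) (λ x → 3 ^ isZero (λ′ ⊗ x ⊕ c₀))
        ≤⟨ *-monoʳ-≤ ((p + 2) ^ N) (sum-3^isZero-affine≤p+2 λ′ c₀ λ′≢𝟘) ⟩
      (p + 2) ^ N * (p + 2)
        ≡⟨ *-comm ((p + 2) ^ N) (p + 2) ⟩
      (p + 2) ^ suc N ∎
      where open ≤-Reasoning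

    module Code (N : ℕ) where

      combination : ∀ {j} → V j → Vec (V N) j → V N
      combination [] [] = 0v
      combination (b ∷ β) (r ∷ rs) = b ·v r +v combination β rs

      lookup-combination : ∀ {j} (β : V j) (rs : Vec (V N) j) t → lookup (combination β rs) t ≡ β ∙ Vec.map (λ r → lookup r t) rs
      lookup-combination [] [] t = lookup-0v t
      lookup-combination (b ∷ β) (r ∷ rs) t =
        trans (lookup-+v (b ·v r) (combination β rs) t) (cong₂ _⊕_ (lookup-·v b r t) (lookup-combination β rs t))

      FewZeros : V N → Set
      FewZeros v = 4 * zeros v < 3 * N

      IsGood : ∀ {j} → Vec (V N) j → Set
      IsGood rs = ∀ β → β ≢ 0v → FewZeros (combination β rs)

      GoodExtension : ∀ {j} → Vec (V N) j → V N → Set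
      GoodExtension rs ρ = ∀ β λ′ → λ′ ≢ 𝟘 → FewZeros (λ′ ·v ρ +v combination β rs)

      extend-good : ∀ {j} {rs : Vec (V N) j} {ρ} → IsGood rs → GoodExtension rs ρ → IsGood (ρ ∷ rs)
      extend-good {rs = rs} {ρ} rs-good ρ-good (b ∷ β) b∷β≢0 with b ≟ 𝟘
      ... | no b≢𝟘 = ρ-good β b b≢𝟘
      ... | yes refl = subst FewZeros (sym (trans (cong (_+v combination β rs) (·v-zeroˡ ρ)) (+v-identityˡ _)))
                             (rs-good β (λ β≡0 → b∷β≢0 (cong (𝟘 ∷_) β≡0)))

      ones : V N
      ones = replicate N 𝟙

      ones-good : 0 < N → IsGood (ones ∷ [])
      ones-good 0<N (b ∷ []) b≢0 = subst FewZeros (sym b·ones≡b…b)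
        (subst (λ z → 4 * z < 3 * N) (sym (zeros-replicate N b≢𝟘)) (*-monoʳ-< 3 0<N))
        where
        b≢𝟘 : b ≢ 𝟘
        b≢𝟘 b≡𝟘 = b≢0 (cong (_∷ []) b≡𝟘)
        b·ones≡b…b : b ·v ones +v 0v ≡ replicate N b
        b·ones≡b…b = trans (+v-identityʳ _) (scale-replicate N)
          where
          scale-replicate : ∀ M → b ·v replicate M 𝟙 ≡ replicate M b
          scale-replicate zero = refl
          scale-replicate (suc M) = cong₂ _∷_ (⊗-identityʳ b) (scale-replicate M)

      record GoodCode (m : ℕ) : Set where
        field
          rows : Vec (V N) m
          good : IsGood rows
          onesRow : Fin m
          lookup-onesRow : lookup rows onesRow ≡ ones

      bad : V N → ℕ
      bad v = if ⌊ 3 * N ≤? 4 * zeros v ⌋ then 1 else 0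

      bad-cases : ∀ v → (3 * N ≤ 4 * zeros v × bad v ≡ 1) ⊎ (FewZeros v × bad v ≡ 0)
      bad-cases v with 3 * N ≤? 4 * zeros v
      ... | yes many = inj₁ (many , refl)
      ... | no ¬many = inj₂ (≰⇒> ¬many , refl)

      bad≡0⇒FewZeros : ∀ v → bad v ≡ 0 → FewZeros v
      bad≡0⇒FewZeros v bad≡0 with bad-cases v
      ... | inj₂ (few , _) = few
      ... | inj₁ (_ , bad≡1) with trans (sym bad≡1) bad≡0
      ...   | ()

      z : ℕ
      z = ⌈3N/4⌉ N

      3^z*bad≤3^zeros : ∀ v → 3 ^ z * bad v ≤ 3 ^ zeros v
      3^z*bad≤3^zeros v with bad-cases v
      ... | inj₁ (many , bad≡1) rewrite bad≡1 = ≤-trans (≤-reflexive (*-identityʳ (3 ^ z))) (^-monoʳ-≤ 3 (3N≤4w⇒⌈3N/4⌉≤w N (zeros v) many))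
      ... | inj₂ (_ , bad≡0) rewrite bad≡0 = ≤-trans (≤-reflexive (*-zeroʳ (3 ^ z))) z≤n

      badFor : ∀ {j} → Vec (V N) j → V j → F p → V N → ℕ
      badFor rs β λ′ ρ = if ⌊ λ′ ≟ 𝟘 ⌋ then 0 else bad (λ′ ·v ρ +v combination β rs)

      badFor-≢𝟘 : ∀ {j} (rs : Vec (V N) j) β {λ′} ρ → λ′ ≢ 𝟘 → badFor rs β λ′ ρ ≡ bad (λ′ ·v ρ +v combination β rs)
      badFor-≢𝟘 rs β {λ′} ρ λ′≢𝟘 with λ′ ≟ 𝟘
      ... | yes λ′≡𝟘 = ⊥-elim (λ′≢𝟘 λ′≡𝟘)
      ... | no _ = refl

      badFor-markov : ∀ {j} (rs : Vec (V N) j) β λ′ → sumBy (vectors N) (badFor rs β λ′) * 3 ^ z ≤ (p + 2) ^ N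
      badFor-markov rs β λ′ with λ′ ≟ 𝟘
      ... | yes _ = ≤-trans (≤-reflexive (cong (_* 3 ^ z) (trans (sumBy-const (vectors N) 0) (*-zeroʳ (length (vectors N)))))) z≤n
      ... | no λ′≢𝟘 = begin
        sumBy (vectors N) (λ ρ → bad (λ′ ·v ρ +v c)) * 3 ^ z     ≡⟨ trans (*-comm _ (3 ^ z)) (sym (sumBy-*ˡ (vectors N) (3 ^ z) _)) ⟩
        sumBy (vectors N) (λ ρ → 3 ^ z * bad (λ′ ·v ρ +v c))     ≤⟨ sumBy-mono-≤ (vectors N) (λ ρ → 3^z*bad≤3^zeros (λ′ ·v ρ +v c)) ⟩
        sumBy (vectors N) (λ ρ → 3 ^ zeros (λ′ ·v ρ +v c))       ≤⟨ sum-3^zeros-affine≤ N λ′ c λ′≢𝟘 ⟩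
        (p + 2) ^ N                                              ∎
        where
        open ≤-Reasoning
        c = combination β rs

      badCount : ∀ {j} → Vec (V N) j → V N → ℕ
      badCount {j} rs ρ = sumBy (vectors j) (λ β → sumBy (allFin p) (λ λ′ → badFor rs β λ′ ρ))

      badCount-total : ∀ {j} (rs : Vec (V N) j) → sumBy (vectors N) (badCount rs) * 3 ^ z ≤ p ^ j * p * (p + 2) ^ N
      badCount-total {j} rs = begin
        sumBy (vectors N) (badCount rs) * 3 ^ z
          ≡⟨ cong (_* 3 ^ z) (trans (sumBy-swap (vectors N) (vectors j) _) (sumBy-cong (vectors j) (λ β → sumBy-swap (vectors N) (allFin p) _))) ⟩
        sumBy (vectors j) (λ β → sumBy (allFin p) (λ λ′ → sumBy (vectors N) (badFor rs β λ′))) * 3 ^ z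
          ≡⟨ trans (*-comm _ (3 ^ z)) (trans (sym (sumBy-*ˡ (vectors j) (3 ^ z) _)) (sumBy-cong (vectors j) (λ β → sym (sumBy-*ˡ (allFin p) (3 ^ z) _)))) ⟩
        sumBy (vectors j) (λ β → sumBy (allFin p) (λ λ′ → 3 ^ z * sumBy (vectors N) (badFor rs β λ′)))
          ≤⟨ sumBy-mono-≤ (vectors j) (λ β → sumBy-mono-≤ (allFin p) (λ λ′ → ≤-trans (≤-reflexive (*-comm (3 ^ z) _)) (badFor-markov rs β λ′))) ⟩
        sumBy (vectors j) (λ β → sumBy (allFin p) (λ λ′ → (p + 2) ^ N))
          ≡⟨ trans (sumBy-cong (vectors j) (λ β → sumBy-const (allFin p) _)) (sumBy-const (vectors j) _) ⟩
        length (vectors j) * (length (allFin p) * (p + 2) ^ N)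
          ≡⟨ cong₂ (λ a b → a * (b * (p + 2) ^ N)) (length-vectors j) (List.length-tabulate {n = p} (λ i → i)) ⟩
        p ^ j * (p * (p + 2) ^ N)
          ≡⟨ sym (*-assoc (p ^ j) p _) ⟩
        p ^ j * p * (p + 2) ^ N ∎
        where open ≤-Reasoning

      ∃goodExtension : ∀ {j} (rs : Vec (V N) j) → p ^ j * p * (p + 2) ^ N < p ^ N * 3 ^ z → ∃ (GoodExtension rs)
      ∃goodExtension {j} rs few-bad with sumBy<length⇒∃≡0 (vectors N) (badCount rs) count<
        where
        count< : sumBy (vectors N) (badCount rs) < length (vectors N)
        count< = subst (sumBy (vectors N) (badCount rs) <_) (sym (length-vectors N))
          (*-cancelʳ-< (3 ^ z) _ (p ^ N) (≤-<-trans (badCount-total rs) few-bad))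
      ... | ρ , _ , badCount≡0 = ρ , ρ-good
        where
        ρ-good : GoodExtension rs ρ
        ρ-good β λ′ λ′≢𝟘 = bad≡0⇒FewZeros (λ′ ·v ρ +v combination β rs) (trans (sym (badFor-≢𝟘 rs β ρ λ′≢𝟘))
          (sumBy≡0⇒∈⇒≡0 (allFin p) (λ λ′ → badFor rs β λ′ ρ)
            (sumBy≡0⇒∈⇒≡0 (vectors j) (λ β → sumBy (allFin p) (λ λ′ → badFor rs β λ′ ρ)) badCount≡0 (∈-vectors β)) (Membership.∈-allFin λ′)))

      goodCode : ∀ m → 0 < N → p ^ suc m * (p + 2) ^ N < p ^ N * 3 ^ z → GoodCode (suc m)
      goodCode zero 0<N _ = record { rows = ones ∷ [] ; good = ones-good 0<N ; onesRow = fzero ; lookup-onesRow = refl }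
      goodCode (suc m) 0<N few-bad = record
        { rows = ρ ∷ rows
        ; good = extend-good good ρ-good
        ; onesRow = fsuc onesRow
        ; lookup-onesRow = lookup-onesRow
        }
        where
        open GoodCode (goodCode m 0<N (≤-<-trans (*-monoˡ-≤ ((p + 2) ^ N) (^-monoʳ-≤ p (n≤1+n (suc m)))) few-bad))
        extension = ∃goodExtension rows (subst (λ w → w * (p + 2) ^ N < p ^ N * 3 ^ z) (*-comm p (p ^ suc m)) few-bad)
        ρ = proj₁ extension
        ρ-good = proj₂ extension

    open Code using (GoodCode)

    -- For N = p the rows 𝟙 and (0, 1, …, p − 1) work: a nonzero combination is affine and non-constant, hence has at most one zero.
    goodCode-p : GoodCode (p ^ 1) 2
    goodCode-p = record
      { rows = identity ∷ ones ∷ []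
      ; good = extend-good (ones-good (m^n>0 p 1)) identity-good
      ; onesRow = fsuc fzero
      ; lookup-onesRow = refl
      }
      where
      open Code (p ^ 1)
      identity : V (p ^ 1)
      identity = tabulate (cast (*-identityʳ p))

      identity-injective : ∀ {s t} → lookup identity s ≡ lookup identity t → s ≡ t
      identity-injective {s} {t} eq = begin
        s                  ≡⟨ sym (cast-involutive (sym (*-identityʳ p)) (*-identityʳ p) s) ⟩
        cast⁻¹ (cast _ s)  ≡⟨ cong cast⁻¹ (trans (sym (lookup∘tabulate _ s)) (trans eq (lookup∘tabulate _ t))) ⟩
        cast⁻¹ (cast _ t)  ≡⟨ cast-involutive (sym (*-identityʳ p)) (*-identityʳ p) t ⟩
        t                  ∎
        where
        open ≡-Reasoning
        cast⁻¹ = cast (sym (*-identityʳ p))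

      identity-good : GoodExtension (ones ∷ []) identity
      identity-good (b ∷ []) λ′ λ′≢𝟘 = ≤-<-trans (*-monoʳ-≤ 4 (zeros≤1 v at-most-one-zero)) 4<3p
        where
        c = b ⊗ 𝟙 ⊕ 𝟘
        v = λ′ ·v identity +v (b ·v ones +v 0v)
        lookup-v : ∀ s → lookup v s ≡ λ′ ⊗ lookup identity s ⊕ c
        lookup-v s = trans (lookup-+v (λ′ ·v identity) _ s)
          (cong₂ _⊕_ (lookup-·v λ′ identity s)
            (trans (lookup-+v (b ·v ones) 0v s) (cong₂ _⊕_ (trans (lookup-·v b ones s) (cong (b ⊗_) (lookup-replicate s 𝟙))) (lookup-0v s))))
        at-most-one-zero : ∀ {s t} → lookup v s ≡ 𝟘 → lookup v t ≡ 𝟘 → s ≡ t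
        at-most-one-zero {s} {t} vs≡𝟘 vt≡𝟘 =
          identity-injective (affine-injective λ′ c λ′≢𝟘 (trans (sym (lookup-v s)) vs≡𝟘) (trans (sym (lookup-v t)) vt≡𝟘))
        4<3p : 4 * 1 < 3 * p ^ 1
        4<3p = ≤-trans (≤ᵇ⇒≤ 5 6 _) (*-monoʳ-≤ 3 (≤-trans 1<p (≤-reflexive (sym (*-identityʳ p)))))

    goodCode-large : ∀ a → 3 ≤ a → GoodCode (p ^ a) (p ^ (a ∸ 3))
    goodCode-large a 3≤a with p ^ (a ∸ 3) in m≡p^[a-3]
    ... | zero = ⊥-elim (<⇒≢ (m^n>0 p (a ∸ 3)) (sym m≡p^[a-3]))
    ... | suc m = Code.goodCode (p ^ a) m (m^n>0 p a)
        (subst (λ w → p ^ suc m * (p + 2) ^ w < p ^ w * 3 ^ Code.z (p ^ a)) (sym N≡p³[1+m])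
          (q^m*[q+2]^N<q^N*3^z p 1<p (suc m) (Code.z (p ^ a)) (subst (λ w → 3 * w ≤ 4 * Code.z (p ^ a)) N≡p³[1+m] (3N≤4⌈3N/4⌉ (p ^ a)))))
      where
      N≡p³[1+m] : p ^ a ≡ p ^ 3 * suc m
      N≡p³[1+m] = trans (cong (p ^_) (sym (m+[n∸m]≡n 3≤a))) (trans (^-distribˡ-+-* p 3 (a ∸ 3)) (cong (p ^ 3 *_) m≡p^[a-3]))

    goodCode-block : ∀ j → GoodCode (p ^ D p j) (d p (suc j))
    goodCode-block zero = record { rows = ones ∷ [] ; good = ones-good (s≤s z≤n) ; onesRow = fzero ; lookup-onesRow = refl }
      where open Code 1
    goodCode-block (suc zero) = goodCode-p
    goodCode-block (suc (suc j)) = goodCode-large (D p (2 + j)) (3≤D[2+j] j)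
      where
      3≤D[2+j] : ∀ j → 3 ≤ D p (2 + j)
      3≤D[2+j] zero = ≤-refl
      3≤D[2+j] (suc j) = ≤-trans (3≤D[2+j] j) (m≤m+n (D p (2 + j)) _)

    module Construction {n a m} (a+m≤n : a + m ≤ n) (code : GoodCode (p ^ a) m) where
      open Code (p ^ a) using (combination; lookup-combination; ones)
      open GoodCode code

      column : V n → V m
      column u = Vec.map (λ r → lookup r (encode a u)) rows

      ξ : V n → V n
      ξ u = embed a (column u) a+m≤n

      ξ≢0v : ∀ u → ξ u ≢ 0v
      ξ≢0v u ξu≡0 = 𝟘≢𝟙 (begin
        𝟘                                          ≡⟨ sym (lookup-0v k) ⟩
        lookup 0v k                                ≡⟨ cong (λ v → lookup v k) (sym ξu≡0) ⟩
        lookup (ξ u) k                             ≡⟨ lookup-embed a (column u) a+m≤n onesRow k (toℕ-fromℕ< _) ⟩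
        lookup (column u) onesRow                  ≡⟨ lookup-map onesRow _ rows ⟩
        lookup (lookup rows onesRow) (encode a u)  ≡⟨ cong (λ r → lookup r (encode a u)) lookup-onesRow ⟩
        lookup ones (encode a u)                   ≡⟨ lookup-replicate (encode a u) 𝟙 ⟩
        𝟙                                          ∎)
        where
        open ≡-Reasoning
        k : Fin n
        k = fromℕ< (≤-trans (+-monoʳ-< a (toℕ<n onesRow)) a+m≤n)

      ξ⊥first : ∀ u → InPerp p (Es p 0 a) (ξ u)
      ξ⊥first u _ = ∙-span≡𝟘 (ξ u) (λ { (k , (_ , k<a) , refl) → trans (∙-unit (ξ u) k) (lookup-embed-< a (column u) a+m≤n k k<a) })

      module _ (L : List (V n)) where

        Ξ : V n → Set
        Ξ w = ∃ λ u → u ∈ L × w ≡ ξ u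

        spanΞ⊆block : ∀ {v} → InSpan p Ξ v → InSpan p (Es p a (a + m)) v
        spanΞ⊆block = span-mono λ { (u , _ , refl) → blockTerms a (column u) a+m≤n , blockTerms⊆Es a a (column u) a+m≤n ≤-refl , refl }

        embed-columns⊆spanΞ : ∀ {x} → InSpan p (_∈ List.map column L) x → InSpan p Ξ (embed a x a+m≤n)
        embed-columns⊆spanΞ = span-map (λ x → embed a x a+m≤n) (embed-0v a a+m≤n) (λ c x y → embed-linear a c x y a+m≤n) generator
          where
          generator : ∀ {w} → w ∈ List.map column L → InSpan p Ξ (embed a w a+m≤n)
          generator w∈ with Membership.∈-map⁻ column w∈
          ... | u , u∈L , refl = span-∈ (u , u∈L , refl)

        -- An annihilator β of the columns of L gives a combination of the rows vanishing at the |L| ≥ 3N/4 distinct positions encode u.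
        no-annihilator : Unique L → All (VanishesFrom a) L → 3 * p ^ a ≤ 4 * length L → ¬ Annihilator (List.map column L)
        no-annihilator uniq L⊆U big (β , β≢0 , β⊥columns) = <⇒≱ (good β β≢0) (≤-trans big (*-monoʳ-≤ 4 many-zeros))
          where
          vanishes : All (λ u → lookup (combination β rows) (encode a u) ≡ 𝟘) L
          vanishes = All.map (λ {u} β⊥ → trans (lookup-combination β rows (encode a u)) β⊥) (All.map⁻ β⊥columns)
          many-zeros : length L ≤ zeros (combination β rows)
          many-zeros = subst (_≤ zeros (combination β rows)) (List.length-map (encode a) L)
            (unique-zeros≤zeros (combination β rows) (List.map (encode a) L)
              (Unique-map⁺-on (encode a) (VanishesFrom a) L uniq L⊆U (encode-injective a)) (All.map⁺ vanishes))

        block⊆spanΞ : Unique L → All (VanishesFrom a) L → 3 * p ^ a ≤ 4 * length L →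
                      ∀ {v} → InSpan p (Es p a (a + m)) v → InSpan p Ξ v
        block⊆spanΞ uniq L⊆U big with spansAll⊎annihilator m (List.map column L)
        ... | inj₂ ann = ⊥-elim (no-annihilator uniq L⊆U big ann)
        ... | inj₁ spans = span-mono λ { (k , (a≤k , k<a+m) , refl) → unit∈spanΞ k a≤k k<a+m }
          where
          unit∈spanΞ : ∀ k → a ≤ toℕ k → toℕ k < a + m → InSpan p Ξ (unit k)
          unit∈spanΞ k a≤k k<a+m = span-resp-≡ (embed-unit a j a+m≤n k k≡a+j) (embed-columns⊆spanΞ (spans (unit j)))
            where
            j : Fin m
            j = fromℕ< (+-cancelˡ-< a (toℕ k ∸ a) m (subst (_< a + m) (sym (m+[n∸m]≡n a≤k)) k<a+m))
            k≡a+j : toℕ k ≡ a + toℕ j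
            k≡a+j = trans (sym (m+[n∸m]≡n a≤k)) (cong (a +_) (sym (toℕ-fromℕ< _)))

corollary2p2 : (p : ℕ) .{{_ : NonZero p}} → Prime p → (n i : ℕ) → 1 ≤ i → D p i ≤ n →
    Σ (Vecₚ p n → Vecₚ p n) λ ξ →
      (∀ u → InU p (i ∸ 1) u → (ξ u ≢ 0V p) × InH p (i ∸ 1) (ξ u))
      × (∀ (L : List (Vecₚ p n)) → Unique L → All (InU p (i ∸ 1)) L →
           3 * p ^ D p (i ∸ 1) ≤ 4 * length L →
           ∀ v → (InSpan p (λ w → ∃ λ u → u ∈ L × w ≡ ξ u) v → InSpan p (Es p (D p (i ∸ 1)) (D p i)) v)
               × (InSpan p (Es p (D p (i ∸ 1)) (D p i)) v → InSpan p (λ w → ∃ λ u → u ∈ L × w ≡ ξ u) v))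
corollary2p2 p prime-p n zero () _
corollary2p2 p prime-p n (suc j) _ D[1+j]≤n =
  ξ , (λ u _ → ξ≢0v u , ξ⊥first u) , λ L uniq L⊆U big v → spanΞ⊆block L , block⊆spanΞ L uniq L⊆U big
  where open Construction p prime-p {a = D p j} D[1+j]≤n (goodCode-block p prime-p j)
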